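{- Let $E: a_1x_1+\cdots+a_kx_k=0$ be an equation with nonzero integer coefficients satisfying $\gcd(a_1,\dots,a_k)=1$, not all of the same sign, and let $m$ be a positive integer. Then \[\limsup_{n\to\infty}\mu_E([n])\le \mu_E(\mathbb{Z}_m).\]
   Context: $[n]=\{1,\dots,n\}$ and $\mathbb{Z}_m$ is the cyclic group of integers modulo $m$. For a finite set $A$ (either $[n]\subset\mathbb{Z}$, or $\mathbb{Z}_m$ with the equation read modulo $m$), $T_E(A)=\{(x_1,\dots,x_k)\in A^k: a_1x_1+\cdots+a_kx_k=0\}$. For a coloring $f:A\to\{ -1,1\}$, $M_E(f)=\{(x_1,\dots,x_k)\in T_E(A): f(x_1)=\cdots=f(x_k)\}$ and $\mu_E(f)=|M_E(f)|/|T_E(A)|$; $\mu_E(A)=\min_{f:A\to\{ -1,1\}}\mu_E(f)$. -}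

module Defs where

open import Data.Nat as ℕ using (ℕ; zero; suc; NonZero)
open import Data.Integer as ℤ using (ℤ; +_; 0ℤ)
open import Data.Integer.GCD using (gcd)
open import Data.Rational as ℚ using (ℚ; 0ℚ; 1ℚ; _⊓_)
open import Data.Fin using (Fin; toℕ)
open import Data.Vec using (Vec; []; _∷_; lookup)
open import Data.List using (List; []; _∷_; map; concatMap; filter; length; foldr; allFin)
open import Data.Bool using (Bool; true; false; _∧_; _∨_; if_then_else_)
open import Relation.Nullary.Decidable using (⌊_⌋)
open import Data.Nat using (_≡ᵇ_)

tuples : {A : Set} → List A → (k : ℕ) → List (Vec A k)
tuples xs zero    = [] ∷ []
tuples xs (suc k) = concatMap (λ x → map (x ∷_) (tuples xs k)) xs

-- A coloring A → {-1,1} is modelled as A → Bool (true ↔ 1, false ↔ -1).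
-- The finite set A is modelled as Fin N; the element represented by i : Fin N
-- is given by an interpretation into ℤ.

linform : {k : ℕ} → Vec ℤ k → Vec ℤ k → ℤ
linform []       []       = 0ℤ
linform (a ∷ as) (x ∷ xs) = a ℤ.* x ℤ.+ linform as xs

interp : {N k : ℕ} → (Fin N → ℤ) → Vec (Fin N) k → Vec ℤ k
interp v []       = []
interp v (x ∷ xs) = v x ∷ interp v xs

allCol : {N k : ℕ} → (Fin N → Bool) → Bool → Vec (Fin N) k → Bool
allCol f b []       = true
allCol f b (x ∷ xs) = ⌊ Data.Bool._≟_ (f x) b ⌋ ∧ allCol f b xs
  where import Data.Bool

mono : {N k : ℕ} → (Fin N → Bool) → Vec (Fin N) k → Bool
mono f xs = allCol f true xs ∨ allCol f false xs

-- p / q as a rational; 0 if q = 0 (only relevant when T_E(A) is empty).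
ratio : ℕ → ℕ → ℚ
ratio p zero    = 0ℚ
ratio p (suc q) = (+ p) ℚ./ suc q

-- Generic finite setting: A = Fin N, `sol` decides membership in T_E(A).
module _ {k : ℕ} (N : ℕ) (sol : Vec (Fin N) k → Bool) where

  T : List (Vec (Fin N) k)
  T = filter (λ xs → sol xs Data.Bool.≟ true) (tuples (allFin N) k)
    where import Data.Bool

  μf : (Fin N → Bool) → ℚ
  μf f = ratio (length (filter (λ xs → mono f xs Data.Bool.≟ true) T)) (length T)
    where import Data.Bool

  -- Colorings are enumerated as Vec Bool N (f = lookup c). Every μ_E(f) ≤ 1,
  -- so folding ⊓ starting from 1 yields exactly the minimum.
  μmin : ℚ
  μmin = foldr (λ c r → μf (lookup c) ⊓ r) 1ℚ (tuples (true ∷ false ∷ []) N)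

-- [n] = {1,…,n}: i : Fin n represents toℕ i + 1; equation over ℤ.
solInt : {k : ℕ} → Vec ℤ k → (n : ℕ) → Vec (Fin n) k → Bool
solInt a n xs = ⌊ linform a (interp (λ i → + suc (toℕ i)) xs) ℤ.≟ 0ℤ ⌋

-- ℤ_m: i : Fin m represents the residue toℕ i; equation read modulo m.
solMod : {k : ℕ} → Vec ℤ k → (m : ℕ) → .{{NonZero m}} → Vec (Fin m) k → Bool
solMod a m xs = (linform a (interp (λ i → + toℕ i) xs) ℤ.%ℕ m) ≡ᵇ 0

μ[n] : {k : ℕ} → Vec ℤ k → ℕ → ℚ
μ[n] a n = μmin n (solInt a n)

μℤ : {k : ℕ} → Vec ℤ k → (m : ℕ) → .{{NonZero m}} → ℚ
μℤ a m = μmin m (solMod a m)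

gcdV : {k : ℕ} → Vec ℤ k → ℤ
gcdV []       = 0ℤ
gcdV (a ∷ as) = gcd a (gcdV as)

-- Fix a colouring g of ℤ_m attaining μ_E(ℤ_m) and colour x ∈ [n] by g(x mod m). Group the solutions in
-- [n]^k by their residue class mod m. Since gcd(a) = 1 there is w with a·w = 1, so for two classes r, r′
-- that solve the equation mod m the vector D = δ − (a·δ) w, δ = r′ − r, satisfies a·D = 0 and D ≡ δ
-- (mod m). Translating by D maps class r into class r′ and loses at most ∥D∥₁ n^(k−2) points of the cube,
-- because a solution is determined by all but one of its coordinates. So all these classes have the same
-- size up to O(n^(k−2)), which gives, for a constant C,
--   #solutions(ℤ_m) · #monochromatic([n]) ≤ #monochromatic(ℤ_m) · #solutions([n]) + C n^(k−2).
-- As a has coefficients of both signs, [n]^k contains at least c n^(k−1) solutions, hence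
-- μ_E([n]) ≤ μ_E(ℤ_m) + O(1/n).
module Submission where

open import Defs
open import Data.Nat as ℕ using (ℕ; NonZero)
open import Data.Bool using (Bool; true; false; if_then_else_; _∧_)
open import Data.Fin using (Fin; toℕ)
open import Data.List as List using (List; []; _∷_)
open import Data.Vec as Vec using (Vec; []; _∷_; lookup)
import Data.Vec.Properties as Vecₚ
open import Data.Product using (∃; _×_; _,_; proj₁; proj₂)
open import Function using (_∘_)
open import Relation.Binary.PropositionalEquality
  using (_≡_; _≢_; refl; sym; trans; cong; cong₂; subst; module ≡-Reasoning)

module FiniteSum where

  open import Data.List.Membership.Propositional using (_∈_)
  open import Data.List.Membership.Propositional.Properties using (∈-map⁺; ∈-concatMap⁺)
  open import Data.List.Relation.Unary.Any as Any using (here; there)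
  import Data.Bool as Bool
  import Data.Fin as Fin
  open import Relation.Nullary using (does)
  open import Data.Nat
  open import Data.Nat.Properties
  open import Algebra.Properties.CommutativeSemigroup +-commutativeSemigroup using () renaming (interchange to +-interchange)

  infix 7 ∑< ∑

  ∑< : ℕ → (ℕ → ℕ) → ℕ
  ∑< zero    f = 0
  ∑< (suc n) f = f 0 + ∑< n (f ∘ suc)

  syntax ∑< n (λ u → e) = ∑[ u < n ] e

  ∑ : {A : Set} → List A → (A → ℕ) → ℕ
  ∑ []       f = 0
  ∑ (x ∷ xs) f = f x + ∑ xs f

  syntax ∑ xs (λ x → e) = ∑[ x ∈ xs ] e

  𝟙 : Bool → ℕ
  𝟙 b = if b then 1 else 0

  ∑<-cong : ∀ n {f g : ℕ → ℕ} → (∀ u → u < n → f u ≡ g u) → ∑< n f ≡ ∑< n g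
  ∑<-cong zero    f≡g = refl
  ∑<-cong (suc n) f≡g = cong₂ _+_ (f≡g 0 z<s) (∑<-cong n (λ u u<n → f≡g (suc u) (s<s u<n)))

  ∑<-mono : ∀ n {f g : ℕ → ℕ} → (∀ u → u < n → f u ≤ g u) → ∑< n f ≤ ∑< n g
  ∑<-mono zero    f≤g = z≤n
  ∑<-mono (suc n) f≤g = +-mono-≤ (f≤g 0 z<s) (∑<-mono n (λ u u<n → f≤g (suc u) (s<s u<n)))

  𝟙-mono : ∀ {b b′} → (b ≡ true → b′ ≡ true) → 𝟙 b ≤ 𝟙 b′
  𝟙-mono {false}          _    = z≤n
  𝟙-mono {true}  {true}  _    = ≤-refl
  𝟙-mono {true}  {false} b⇒b′ with () ← b⇒b′ refl

  ∑<-const : ∀ n c → ∑[ _ < n ] c ≡ n * c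
  ∑<-const zero    c = refl
  ∑<-const (suc n) c = cong (c +_) (∑<-const n c)

  ∑<-≤-const : ∀ n {f : ℕ → ℕ} {c} → (∀ u → f u ≤ c) → ∑< n f ≤ n * c
  ∑<-≤-const n {c = c} f≤c = ≤-trans (∑<-mono n (λ u _ → f≤c u)) (≤-reflexive (∑<-const n c))

  ∑<-+ : ∀ n (f g : ℕ → ℕ) → ∑[ u < n ] (f u + g u) ≡ ∑< n f + ∑< n g
  ∑<-+ zero    f g = refl
  ∑<-+ (suc n) f g = trans (cong (f 0 + g 0 +_) (∑<-+ n (f ∘ suc) (g ∘ suc)))
                           (+-interchange (f 0) (g 0) _ _)

  ∑<-*ˡ : ∀ n c (f : ℕ → ℕ) → ∑[ u < n ] (c * f u) ≡ c * ∑< n f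
  ∑<-*ˡ zero    c f = sym (*-zeroʳ c)
  ∑<-*ˡ (suc n) c f = trans (cong (c * f 0 +_) (∑<-*ˡ n c (f ∘ suc))) (sym (*-distribˡ-+ c (f 0) _))

  ∑<-comm : ∀ n p (H : ℕ → ℕ → ℕ) → ∑[ u < n ] ∑[ v < p ] H u v ≡ ∑[ v < p ] ∑[ u < n ] H u v
  ∑<-comm zero    p H = sym (trans (∑<-const p 0) (*-zeroʳ p))
  ∑<-comm (suc n) p H = trans (cong (∑< p (H 0) +_) (∑<-comm n p (H ∘ suc)))
                              (sym (∑<-+ p (H 0) (λ v → ∑[ u < n ] H (suc u) v)))

  ∑<-snoc : ∀ n (f : ℕ → ℕ) → ∑< (suc n) f ≡ ∑< n f + f n
  ∑<-snoc zero    f = +-comm (f 0) 0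
  ∑<-snoc (suc n) f = trans (cong (f 0 +_) (∑<-snoc n (f ∘ suc))) (sym (+-assoc (f 0) _ _))

  ∑<-split : ∀ n p (f : ℕ → ℕ) → ∑< (n + p) f ≡ ∑< n f + ∑[ u < p ] f (n + u)
  ∑<-split zero    p f = refl
  ∑<-split (suc n) p f = trans (cong (f 0 +_) (∑<-split n p (f ∘ suc))) (sym (+-assoc (f 0) _ _))

  ∑<-blocks : ∀ w α (f : ℕ → ℕ) → ∑< (w * α) f ≡ ∑[ t < w ] ∑[ s < α ] f (t * α + s)
  ∑<-blocks zero    α f = refl
  ∑<-blocks (suc w) α f = trans (∑<-split α (w * α) f) (cong (∑< α f +_) (trans
    (∑<-blocks w α (λ u → f (α + u)))
    (∑<-cong w (λ t _ → ∑<-cong α (λ s _ → cong f (sym (+-assoc α (t * α) s)))))))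

  ∑<-≤-extend : ∀ {m n} (g : ℕ → ℕ) → m ≤ n → ∑< m g ≤ ∑< n g
  ∑<-≤-extend {m} {n} g m≤n = begin
    ∑< m g                              ≤⟨ m≤m+n _ _ ⟩
    ∑< m g + ∑[ u < n ∸ m ] g (m + u)   ≡⟨ ∑<-split m (n ∸ m) g ⟨
    ∑< (m + (n ∸ m)) g                  ≡⟨ cong (λ p → ∑< p g) (m+[n∸m]≡n m≤n) ⟩
    ∑< n g                              ∎
    where open ≤-Reasoning

  ∑<-stride-≤ : ∀ {n} β w α (g : ℕ → ℕ) → 1 ≤ α → β + w * α ≤ n → ∑[ t < w ] g (β + t * α) ≤ ∑< n g
  ∑<-stride-≤ {n} β w α@(suc _) g _ β+wα≤n = begin
    ∑[ t < w ] g (β + t * α)                   ≤⟨ ∑<-mono w (λ t _ → first-of-block t) ⟩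
    ∑[ t < w ] ∑[ s < α ] g (β + (t * α + s))  ≡⟨ ∑<-blocks w α (λ u → g (β + u)) ⟨
    ∑[ u < w * α ] g (β + u)                   ≤⟨ m≤n+m _ (∑< β g) ⟩
    ∑< β g + ∑[ u < w * α ] g (β + u)          ≡⟨ ∑<-split β (w * α) g ⟨
    ∑< (β + w * α) g                           ≤⟨ ∑<-≤-extend g β+wα≤n ⟩
    ∑< n g                                     ∎
    where
    open ≤-Reasoning
    first-of-block : ∀ t → g (β + t * α) ≤ ∑[ s < α ] g (β + (t * α + s))
    first-of-block t = subst (λ v → g (β + v) ≤ ∑[ s < α ] g (β + (t * α + s)))
                             (+-identityʳ (t * α)) (m≤m+n _ _)

  ∑<-≤1 : ∀ n (P : ℕ → Bool) → (∀ u v → P u ≡ true → P v ≡ true → u ≡ v) → ∑[ u < n ] 𝟙 (P u) ≤ 1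
  ∑<-≤1 zero    P unique = z≤n
  ∑<-≤1 (suc n) P unique with P 0 in P0
  ... | false = ∑<-≤1 n (P ∘ suc) (λ u v Pu Pv → suc-injective (unique (suc u) (suc v) Pu Pv))
  ... | true  = s≤s (≤-reflexive (trans (∑<-cong n P-false) (trans (∑<-const n 0) (*-zeroʳ n))))
    where
    P-false : ∀ u → u < n → 𝟙 (P (suc u)) ≡ 0
    P-false u _ with P (suc u) in Pu
    ... | false = refl
    ... | true with () ← unique 0 (suc u) P0 Pu

  ∑<-≥-term : ∀ n (f : ℕ → ℕ) {u} → u < n → f u ≤ ∑< n f
  ∑<-≥-term (suc n) f {zero}  _         = m≤m+n (f 0) _
  ∑<-≥-term (suc n) f {suc u} (s<s u<n) = ≤-trans (∑<-≥-term n (f ∘ suc) u<n) (m≤n+m _ (f 0))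

  module _ {A : Set} where

    ∑-cong : (xs : List A) {f g : A → ℕ} → (∀ x → f x ≡ g x) → ∑ xs f ≡ ∑ xs g
    ∑-cong []       f≡g = refl
    ∑-cong (x ∷ xs) f≡g = cong₂ _+_ (f≡g x) (∑-cong xs f≡g)

    ∑-mono : (xs : List A) {f g : A → ℕ} → (∀ x → f x ≤ g x) → ∑ xs f ≤ ∑ xs g
    ∑-mono []       f≤g = z≤n
    ∑-mono (x ∷ xs) f≤g = +-mono-≤ (f≤g x) (∑-mono xs f≤g)

    ∑-zero : (xs : List A) → ∑[ _ ∈ xs ] 0 ≡ 0
    ∑-zero []       = refl
    ∑-zero (x ∷ xs) = ∑-zero xs

    ∑-+ : (xs : List A) (f g : A → ℕ) → ∑[ x ∈ xs ] (f x + g x) ≡ ∑ xs f + ∑ xs g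
    ∑-+ []       f g = refl
    ∑-+ (x ∷ xs) f g = trans (cong (f x + g x +_) (∑-+ xs f g)) (+-interchange (f x) (g x) _ _)

    ∑-*ˡ : (xs : List A) (c : ℕ) (f : A → ℕ) → ∑[ x ∈ xs ] (c * f x) ≡ c * ∑ xs f
    ∑-*ˡ []       c f = sym (*-zeroʳ c)
    ∑-*ˡ (x ∷ xs) c f = trans (cong (c * f x +_) (∑-*ˡ xs c f)) (sym (*-distribˡ-+ c (f x) _))

    ∑-*ʳ : (xs : List A) (f : A → ℕ) (c : ℕ) → ∑[ x ∈ xs ] (f x * c) ≡ ∑ xs f * c
    ∑-*ʳ xs f c = trans (∑-cong xs (λ x → *-comm (f x) c)) (trans (∑-*ˡ xs c f) (*-comm c _))

    ∑-++ : (xs ys : List A) (f : A → ℕ) → ∑ (xs List.++ ys) f ≡ ∑ xs f + ∑ ys f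
    ∑-++ []       ys f = refl
    ∑-++ (x ∷ xs) ys f = trans (cong (f x +_) (∑-++ xs ys f)) (sym (+-assoc (f x) _ _))

    ∑-map : {B : Set} (g : B → A) (ys : List B) (f : A → ℕ) → ∑ (List.map g ys) f ≡ ∑[ y ∈ ys ] f (g y)
    ∑-map g []       f = refl
    ∑-map g (y ∷ ys) f = cong (f (g y) +_) (∑-map g ys f)

    ∑-concatMap : {B : Set} (g : B → List A) (ys : List B) (f : A → ℕ) →
                  ∑ (List.concatMap g ys) f ≡ ∑[ y ∈ ys ] ∑ (g y) f
    ∑-concatMap g []       f = refl
    ∑-concatMap g (y ∷ ys) f = trans (∑-++ (g y) _ f) (cong (∑ (g y) f +_) (∑-concatMap g ys f))

    ∑-∑<-comm : (xs : List A) (n : ℕ) (H : A → ℕ → ℕ) → ∑[ x ∈ xs ] ∑< n (H x) ≡ ∑[ u < n ] ∑[ x ∈ xs ] H x u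
    ∑-∑<-comm []       n H = sym (trans (∑<-const n 0) (*-zeroʳ n))
    ∑-∑<-comm (x ∷ xs) n H = trans (cong (∑< n (H x) +_) (∑-∑<-comm xs n H))
                                   (sym (∑<-+ n (H x) (λ u → ∑[ y ∈ xs ] H y u)))

  module _ {A : Set} where

    ∑-≥-∈ : (xs : List A) (f : A → ℕ) {x : A} → x ∈ xs → f x ≤ ∑ xs f
    ∑-≥-∈ (y ∷ xs) f (here refl) = m≤m+n (f y) _
    ∑-≥-∈ (y ∷ xs) f (there x∈) = ≤-trans (∑-≥-∈ xs f x∈) (m≤n+m _ (f y))

    length-filter : (xs : List A) (P : A → Bool) →
                    List.length (List.filter (λ x → P x Bool.≟ true) xs) ≡ ∑[ x ∈ xs ] 𝟙 (P x)
    length-filter []       P = refl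
    length-filter (x ∷ xs) P with P x
    ... | true  = cong suc (length-filter xs P)
    ... | false = length-filter xs P

    ∑-filter : (xs : List A) (P : A → Bool) (f : A → ℕ) →
               ∑ (List.filter (λ x → P x Bool.≟ true) xs) f ≡ ∑[ x ∈ xs ] (if P x then f x else 0)
    ∑-filter []       P f = refl
    ∑-filter (x ∷ xs) P f with P x
    ... | true  = cong (f x +_) (∑-filter xs P f)
    ... | false = ∑-filter xs P f

    ∑-tuples : (xs : List A) (k : ℕ) (f : Vec A (suc k) → ℕ) →
               ∑ (tuples xs (suc k)) f ≡ ∑[ x ∈ xs ] ∑[ v ∈ tuples xs k ] f (x ∷ v)
    ∑-tuples xs k f = trans (∑-concatMap _ xs f) (∑-cong xs (λ x → ∑-map (x ∷_) (tuples xs k) f))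

    ∈-tuples : (xs : List A) {k : ℕ} (v : Vec A k) → (∀ i → lookup v i ∈ xs) → v ∈ tuples xs k
    ∈-tuples xs []      _   = here refl
    ∈-tuples xs (x ∷ v) v∈ =
      ∈-concatMap⁺ _ (Any.map (λ { refl → ∈-map⁺ (x ∷_) (∈-tuples xs v (v∈ ∘ Fin.suc)) }) (v∈ Fin.zero))

  ∑-tabulate : ∀ {A : Set} {n} (h : Fin n → A) (f : A → ℕ) →
               ∑ (List.tabulate h) f ≡ ∑[ i ∈ List.allFin n ] f (h i)
  ∑-tabulate {n = zero}  h f = refl
  ∑-tabulate {n = suc n} h f = cong (f (h Fin.zero) +_)
    (trans (∑-tabulate (h ∘ Fin.suc) f) (sym (∑-tabulate Fin.suc (f ∘ h))))

  ∑-allFin-suc : ∀ n (f : Fin (suc n) → ℕ) →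
                 ∑ (List.allFin (suc n)) f ≡ f Fin.zero + ∑[ i ∈ List.allFin n ] f (Fin.suc i)
  ∑-allFin-suc n f = cong (f Fin.zero +_) (∑-tabulate Fin.suc f)

  ∑-allFin : ∀ n (g : ℕ → ℕ) → ∑[ i ∈ List.allFin n ] g (toℕ i) ≡ ∑< n g
  ∑-allFin zero    g = refl
  ∑-allFin (suc n) g = trans (∑-allFin-suc n (g ∘ toℕ)) (cong (g 0 +_) (∑-allFin n (g ∘ suc)))

  ∑-allFin-δ : ∀ n (j : Fin n) (c : Fin n → ℕ) →
               ∑[ i ∈ List.allFin n ] (if does (j Fin.≟ i) then c i else 0) ≡ c j
  ∑-allFin-δ (suc n) Fin.zero    c = trans (∑-allFin-suc n (λ i → if does (Fin.zero Fin.≟ i) then c i else 0))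
                                           (trans (cong (c Fin.zero +_) (∑-zero (List.allFin n))) (+-identityʳ _))
  ∑-allFin-δ (suc n) (Fin.suc j) c = trans (∑-allFin-suc n (λ i → if does (Fin.suc j Fin.≟ i) then c i else 0))
                                           (∑-allFin-δ n j (c ∘ Fin.suc))

module LinearForm where

  open import Data.Integer hiding (suc)
  open import Data.Integer.Properties
  open import Data.Integer.Tactic.RingSolver using (solve-∀)
  import Data.Nat as ℕ
  import Data.Nat.Properties as ℕ
  import Data.Nat.GCD as ℕ
  open import Data.Integer.GCD using (gcd)
  open import Data.Nat using (ℕ)
  open import Data.Fin using (zero; suc)

  infixl 6 _+ᵛ_ _-ᵛ_
  infixr 7 _·ᵛ_

  _+ᵛ_ : ∀ {k} → Vec ℤ k → Vec ℤ k → Vec ℤ k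
  _+ᵛ_ = Vec.zipWith _+_

  _-ᵛ_ : ∀ {k} → Vec ℤ k → Vec ℤ k → Vec ℤ k
  _-ᵛ_ = Vec.zipWith _-_

  _·ᵛ_ : ∀ {k} → ℤ → Vec ℤ k → Vec ℤ k
  c ·ᵛ X = Vec.map (c *_) X

  ∥_∥₁ : ∀ {k} → Vec ℤ k → ℕ
  ∥ []    ∥₁ = 0
  ∥ x ∷ X ∥₁ = ∣ x ∣ ℕ.+ ∥ X ∥₁

  linform-+ : ∀ {k} (a X Y : Vec ℤ k) → linform a (X +ᵛ Y) ≡ linform a X + linform a Y
  linform-+ []       []      []      = refl
  linform-+ (a ∷ as) (x ∷ X) (y ∷ Y) =
    trans (cong (λ s → a * (x + y) + s) (linform-+ as X Y)) (distrib a x y _ _)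
    where
    distrib : ∀ a x y p q → a * (x + y) + (p + q) ≡ (a * x + p) + (a * y + q)
    distrib = solve-∀

  linform-- : ∀ {k} (a X Y : Vec ℤ k) → linform a (X -ᵛ Y) ≡ linform a X - linform a Y
  linform-- []       []      []      = refl
  linform-- (a ∷ as) (x ∷ X) (y ∷ Y) =
    trans (cong (λ s → a * (x - y) + s) (linform-- as X Y)) (distrib a x y _ _)
    where
    distrib : ∀ a x y p q → a * (x - y) + (p - q) ≡ (a * x + p) - (a * y + q)
    distrib = solve-∀

  linform-· : ∀ {k} (a X : Vec ℤ k) c → linform a (c ·ᵛ X) ≡ c * linform a X
  linform-· []       []      c = sym (*-zeroʳ c)
  linform-· (a ∷ as) (x ∷ X) c =
    trans (cong (λ s → a * (c * x) + s) (linform-· as X c)) (distrib a x c _)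
    where
    distrib : ∀ a x c p → a * (c * x) + c * p ≡ c * (a * x + p)
    distrib = solve-∀

  linform-zeros : ∀ {k} (a : Vec ℤ k) → linform a (Vec.replicate k 0ℤ) ≡ 0ℤ
  linform-zeros []       = refl
  linform-zeros (a ∷ as) = cong₂ _+_ (*-zeroʳ a) (linform-zeros as)

  ∣linform∣≤ : ∀ {k} (a : Vec ℤ k) (t : Vec ℕ k) w → (∀ i → lookup t i ℕ.≤ w) →
               ∣ linform a (Vec.map +_ t) ∣ ℕ.≤ ∥ a ∥₁ ℕ.* w
  ∣linform∣≤ []       []       w t≤w = ℕ.z≤n
  ∣linform∣≤ (a ∷ as) (t ∷ ts) w t≤w = begin
    ∣ a * + t + linform as (Vec.map +_ ts) ∣        ≤⟨ ∣i+j∣≤∣i∣+∣j∣ (a * + t) _ ⟩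
    ∣ a * + t ∣ ℕ.+ ∣ linform as (Vec.map +_ ts) ∣ ≤⟨ ℕ.+-mono-≤ ∣at∣≤ (∣linform∣≤ as ts w (t≤w ∘ suc)) ⟩
    ∣ a ∣ ℕ.* w ℕ.+ ∥ as ∥₁ ℕ.* w                   ≡⟨ ℕ.*-distribʳ-+ w ∣ a ∣ ∥ as ∥₁ ⟨
    ∥ a ∷ as ∥₁ ℕ.* w                               ∎
    where
    open ℕ.≤-Reasoning
    ∣at∣≤ : ∣ a * + t ∣ ℕ.≤ ∣ a ∣ ℕ.* w
    ∣at∣≤ = ℕ.≤-trans (ℕ.≤-reflexive (∣i*j∣≡∣i∣*∣j∣ a (+ t))) (ℕ.*-monoʳ-≤ ∣ a ∣ (t≤w zero))

  solution-unique : ∀ a {w w′} e → a ≢ 0ℤ → a * w + e ≡ 0ℤ → a * w′ + e ≡ 0ℤ → w ≡ w′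
  solution-unique a {w} {w′} e a≢0 aw+e≡0 aw′+e≡0 = *-cancelˡ-≡ a w w′ {{≢-nonZero a≢0}} (begin
    a * w             ≡⟨ shift (a * w) e ⟩
    (a * w + e) - e   ≡⟨ cong (_- e) (trans aw+e≡0 (sym aw′+e≡0)) ⟩
    (a * w′ + e) - e  ≡⟨ shift (a * w′) e ⟨
    a * w′            ∎)
    where
    open ≡-Reasoning
    shift : ∀ p e → p ≡ (p + e) - e
    shift = solve-∀

  pos⁺ : ℤ → ℕ
  pos⁺ (+ n)    = n
  pos⁺ -[1+ n ] = 0

  neg⁻ : ℤ → ℕ
  neg⁻ (+ n)    = 0
  neg⁻ -[1+ n ] = ℕ.suc n

  posWeight negWeight : ∀ {k} → Vec ℤ k → ℕ
  posWeight []      = 0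
  posWeight (x ∷ a) = pos⁺ x ℕ.+ posWeight a
  negWeight []      = 0
  negWeight (x ∷ a) = neg⁻ x ℕ.+ negWeight a

  -- Choosing xᵢ = Q for aᵢ > 0 and xᵢ = P otherwise gives a·x = P Q − Q P = 0, where P and Q are
  -- the total weights of the positive and of the negative coefficients.
  balance : ℕ → ℕ → ℤ → ℕ
  balance P Q +0       = P
  balance P Q +[1+ _ ] = Q
  balance P Q -[1+ _ ] = P

  1≤posWeight : ∀ {k} (a : Vec ℤ k) i → 0ℤ < lookup a i → 1 ℕ.≤ posWeight a
  1≤posWeight (+[1+ _ ] ∷ a) zero    _      = ℕ.s≤s ℕ.z≤n
  1≤posWeight (+0 ∷ a)       zero    (+<+ ())
  1≤posWeight (x ∷ a)        (suc i) 0<aᵢ = ℕ.≤-trans (1≤posWeight a i 0<aᵢ) (ℕ.m≤n+m _ (pos⁺ x))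

  1≤negWeight : ∀ {k} (a : Vec ℤ k) i → lookup a i < 0ℤ → 1 ℕ.≤ negWeight a
  1≤negWeight (-[1+ _ ] ∷ a) zero    _      = ℕ.s≤s ℕ.z≤n
  1≤negWeight (+ _ ∷ a)      zero    (+<+ ())
  1≤negWeight (x ∷ a)        (suc i) aᵢ<0 = ℕ.≤-trans (1≤negWeight a i aᵢ<0) (ℕ.m≤n+m _ (neg⁻ x))

  balanced : ∀ {k} → Vec ℤ k → Vec ℕ k
  balanced a = Vec.map (balance (posWeight a) (negWeight a)) a

  balance-bounds : ∀ {P Q} x → 1 ℕ.≤ P → 1 ℕ.≤ Q → 1 ℕ.≤ balance P Q x × balance P Q x ℕ.≤ P ℕ.+ Q
  balance-bounds {P} {Q} +0       1≤P 1≤Q = 1≤P , ℕ.m≤m+n P Q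
  balance-bounds {P} {Q} +[1+ _ ] 1≤P 1≤Q = 1≤Q , ℕ.m≤n+m Q P
  balance-bounds {P} {Q} -[1+ _ ] 1≤P 1≤Q = 1≤P , ℕ.m≤m+n P Q

  private
    linform-balance : ∀ {k} (a : Vec ℤ k) P Q →
      linform a (Vec.map (+_ ∘ balance P Q) a) ≡ + (posWeight a ℕ.* Q) - + (negWeight a ℕ.* P)
    linform-balance []       P Q = refl
    linform-balance (x ∷ as) P Q = begin
      x * + balance P Q x + linform as (Vec.map (+_ ∘ balance P Q) as)
        ≡⟨ cong₂ _+_ (term x) (linform-balance as P Q) ⟩
      (+ (pos⁺ x ℕ.* Q) - + (neg⁻ x ℕ.* P)) + (+ (posWeight as ℕ.* Q) - + (negWeight as ℕ.* P))
        ≡⟨ regroup (+ (pos⁺ x ℕ.* Q)) (+ (neg⁻ x ℕ.* P)) (+ (posWeight as ℕ.* Q)) (+ (negWeight as ℕ.* P)) ⟩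
      (+ (pos⁺ x ℕ.* Q) + + (posWeight as ℕ.* Q)) - (+ (neg⁻ x ℕ.* P) + + (negWeight as ℕ.* P))
        ≡⟨ cong₂ _-_ (trans (sym (pos-+ (pos⁺ x ℕ.* Q) _)) (cong +_ (sym (ℕ.*-distribʳ-+ Q (pos⁺ x) _))))
                     (trans (sym (pos-+ (neg⁻ x ℕ.* P) _)) (cong +_ (sym (ℕ.*-distribʳ-+ P (neg⁻ x) _)))) ⟩
      + (posWeight (x ∷ as) ℕ.* Q) - + (negWeight (x ∷ as) ℕ.* P)
        ∎
      where
      open ≡-Reasoning
      regroup : ∀ p q r s → (p - q) + (r - s) ≡ (p + r) - (q + s)
      regroup = solve-∀
      negate : ∀ x y → - x * y ≡ 0ℤ - x * y
      negate = solve-∀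
      term : ∀ x → x * + balance P Q x ≡ + (pos⁺ x ℕ.* Q) - + (neg⁻ x ℕ.* P)
      term +0           = refl
      term x@(+[1+ _ ]) = trans (sym (pos-* (pos⁺ x) Q)) (sym (+-identityʳ _))
      term x@(-[1+ _ ]) = trans (negate (+ neg⁻ x) (+ P)) (cong (_-_ 0ℤ) (sym (pos-* (neg⁻ x) P)))

  linform-balanced : ∀ {k} (a : Vec ℤ k) → linform a (Vec.map +_ (balanced a)) ≡ 0ℤ
  linform-balanced a = begin
    linform a (Vec.map +_ (balanced a))  ≡⟨ cong (linform a) (Vecₚ.map-∘ +_ _ a) ⟨
    linform a (Vec.map (+_ ∘ balance P Q) a) ≡⟨ linform-balance a P Q ⟩
    + (P ℕ.* Q) - + (Q ℕ.* P)            ≡⟨ cong (λ z → + (P ℕ.* Q) - + z) (ℕ.*-comm Q P) ⟩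
    + (P ℕ.* Q) - + (P ℕ.* Q)            ≡⟨ +-inverseʳ (+ (P ℕ.* Q)) ⟩
    0ℤ                                   ∎
    where
    open ≡-Reasoning
    P = posWeight a
    Q = negWeight a

  withSignOf : ℤ → ℤ → ℤ
  withSignOf (+ _)    ℓ = ℓ
  withSignOf -[1+ _ ] ℓ = - ℓ

  *-withSignOf : ∀ a ℓ → a * withSignOf a ℓ ≡ + ∣ a ∣ * ℓ
  *-withSignOf (+ _)        ℓ = refl
  *-withSignOf a@(-[1+ _ ]) ℓ = negate² (+ ∣ a ∣) ℓ
    where
    negate² : ∀ x ℓ → - x * - ℓ ≡ x * ℓ
    negate² = solve-∀

  ∣withSignOf∣ : ∀ a ℓ → ∣ withSignOf a ℓ ∣ ≡ ∣ ℓ ∣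
  ∣withSignOf∣ (+ _)    ℓ = refl
  ∣withSignOf∣ -[1+ _ ] ℓ = ∣-i∣≡∣i∣ ℓ

  private
    ℕ-identity⇒ℤ : ∀ {d X Y x′ y′} → d ℕ.+ y′ ℕ.* Y ≡ x′ ℕ.* X → + d ≡ + X * + x′ - + Y * + y′
    ℕ-identity⇒ℤ {d} {X} {Y} {x′} {y′} eq = begin
      + d                          ≡⟨ cancel (+ d) (+ y′ * + Y) ⟩
      + d + + y′ * + Y - + y′ * + Y  ≡⟨ cong (λ z → z - + y′ * + Y) lifted ⟩
      + x′ * + X - + y′ * + Y        ≡⟨ cong₂ _-_ (*-comm (+ x′) (+ X)) (*-comm (+ y′) (+ Y)) ⟩
      + X * + x′ - + Y * + y′        ∎
      where
      open ≡-Reasoning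
      cancel : ∀ p q → p ≡ p + q - q
      cancel = solve-∀
      lifted : + d + + y′ * + Y ≡ + x′ * + X
      lifted = trans (cong (_+_ (+ d)) (sym (pos-* y′ Y)))
                     (trans (sym (pos-+ d (y′ ℕ.* Y))) (trans (cong +_ eq) (pos-* x′ X)))

  bézout : ∀ x y → ∃ λ u → ∃ λ v → x * u + y * v ≡ gcd x y
  bézout x y with ℕ.Bézout.identity (ℕ.gcd-GCD ∣ x ∣ ∣ y ∣)
  ... | ℕ.Bézout.+- x′ y′ eq = withSignOf x (+ x′) , - withSignOf y (+ y′) , (begin
    x * withSignOf x (+ x′) + y * - withSignOf y (+ y′) ≡⟨ regroup x y _ _ ⟩
    x * withSignOf x (+ x′) - y * withSignOf y (+ y′)   ≡⟨ cong₂ _-_ (*-withSignOf x _) (*-withSignOf y _) ⟩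
    + ∣ x ∣ * + x′ - + ∣ y ∣ * + y′                    ≡⟨ ℕ-identity⇒ℤ {X = ∣ x ∣} {Y = ∣ y ∣} eq ⟨
    gcd x y                                             ∎)
    where
    open ≡-Reasoning
    regroup : ∀ x y u v → x * u + y * - v ≡ x * u - y * v
    regroup = solve-∀
  ... | ℕ.Bézout.-+ x′ y′ eq = - withSignOf x (+ x′) , withSignOf y (+ y′) , (begin
    x * - withSignOf x (+ x′) + y * withSignOf y (+ y′) ≡⟨ regroup x y _ _ ⟩
    y * withSignOf y (+ y′) - x * withSignOf x (+ x′)   ≡⟨ cong₂ _-_ (*-withSignOf y _) (*-withSignOf x _) ⟩
    + ∣ y ∣ * + y′ - + ∣ x ∣ * + x′                    ≡⟨ ℕ-identity⇒ℤ {X = ∣ y ∣} {Y = ∣ x ∣} eq ⟨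
    gcd x y                                             ∎)
    where
    open ≡-Reasoning
    regroup : ∀ x y u v → x * - u + y * v ≡ y * v - x * u
    regroup = solve-∀

  bézoutᵛ : ∀ {k} (a : Vec ℤ k) → ∃ λ w → linform a w ≡ gcdV a
  bézoutᵛ []      = [] , refl
  bézoutᵛ (x ∷ a) with bézoutᵛ a | bézout x (gcdV a)
  ... | w , aw≡g | u , v , xu+gv≡gcd = u ∷ v ·ᵛ w , (begin
    x * u + linform a (v ·ᵛ w) ≡⟨ cong (_+_ (x * u)) (linform-· a w v) ⟩
    x * u + v * linform a w    ≡⟨ cong (λ s → x * u + v * s) aw≡g ⟩
    x * u + v * gcdV a         ≡⟨ cong (_+_ (x * u)) (*-comm v (gcdV a)) ⟩
    x * u + gcdV a * v         ≡⟨ xu+gv≡gcd ⟩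
    gcd x (gcdV a)             ∎)
    where open ≡-Reasoning

module CubeSum where

  open FiniteSum
  open import Data.Nat
  open import Data.Nat.Properties
  open import Data.Integer as ℤ using (ℤ; +_; 0ℤ)
  open import Relation.Nullary using (yes; no; contradiction)
  open import Relation.Nullary.Decidable using (⌊_⌋)

  lineSum : ℕ → (ℤ → ℕ) → ℕ
  lineSum n h = ∑[ u < n ] h (+ suc u)

  cubeSum : ℕ → (k : ℕ) → (Vec ℤ k → ℕ) → ℕ
  cubeSum n zero    G = G []
  cubeSum n (suc k) G = lineSum n (λ y → cubeSum n k (G ∘ (y ∷_)))

  cubeSum-cong : ∀ n k {G H : Vec ℤ k → ℕ} → (∀ X → G X ≡ H X) → cubeSum n k G ≡ cubeSum n k H
  cubeSum-cong n zero    G≡H = G≡H []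
  cubeSum-cong n (suc k) G≡H = ∑<-cong n (λ u _ → cubeSum-cong n k (G≡H ∘ (_ ∷_)))

  cubeSum-mono : ∀ n k {G H : Vec ℤ k → ℕ} → (∀ X → G X ≤ H X) → cubeSum n k G ≤ cubeSum n k H
  cubeSum-mono n zero    G≤H = G≤H []
  cubeSum-mono n (suc k) G≤H = ∑<-mono n (λ u _ → cubeSum-mono n k (G≤H ∘ (_ ∷_)))

  cubeSum-∑ : ∀ {A : Set} n k (xs : List A) (H : Vec ℤ k → A → ℕ) →
              cubeSum n k (λ X → ∑ xs (H X)) ≡ ∑[ x ∈ xs ] cubeSum n k (λ X → H X x)
  cubeSum-∑ n zero    xs H = refl
  cubeSum-∑ n (suc k) xs H = trans (∑<-cong n (λ u _ → cubeSum-∑ n k xs (H ∘ (+ suc u ∷_))))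
                                   (sym (∑-∑<-comm xs n (λ x u → cubeSum n k (λ X → H (+ suc u ∷ X) x))))

  cubeSum-∑< : ∀ n k p (H : Vec ℤ k → ℕ → ℕ) →
               cubeSum n k (λ X → ∑< p (H X)) ≡ ∑[ t < p ] cubeSum n k (λ X → H X t)
  cubeSum-∑< n zero    p H = refl
  cubeSum-∑< n (suc k) p H = trans (∑<-cong n (λ u _ → cubeSum-∑< n k p (H ∘ (+ suc u ∷_))))
                                   (∑<-comm n p (λ u t → cubeSum n k (λ X → H (+ suc u ∷ X) t)))

  cubeSum-lineSum : ∀ n k p (H : Vec ℤ k → ℤ → ℕ) →
                    cubeSum n k (λ X → lineSum p (H X)) ≡ lineSum p (λ y → cubeSum n k (λ X → H X y))
  cubeSum-lineSum n k p H = cubeSum-∑< n k p (λ X u → H X (+ suc u))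

  cubeSum-*ˡ : ∀ n k c (G : Vec ℤ k → ℕ) → cubeSum n k (λ X → c * G X) ≡ c * cubeSum n k G
  cubeSum-*ˡ n zero    c G = refl
  cubeSum-*ˡ n (suc k) c G = trans (∑<-cong n (λ u _ → cubeSum-*ˡ n k c (G ∘ (+ suc u ∷_))))
                                   (∑<-*ˡ n c _)

  position : ∀ {n} → Fin n → ℤ
  position i = + suc (toℕ i)

  ∑-tuples-cubeSum : ∀ n k (H : Vec ℤ k → ℕ) →
                     ∑[ x ∈ tuples (List.allFin n) k ] H (interp position x) ≡ cubeSum n k H
  ∑-tuples-cubeSum n zero    H = +-identityʳ (H [])
  ∑-tuples-cubeSum n (suc k) H = begin
    ∑[ x ∈ tuples (List.allFin n) (suc k) ] H (interp position x)
      ≡⟨ ∑-tuples (List.allFin n) k _ ⟩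
    ∑[ i ∈ List.allFin n ] ∑[ x ∈ tuples (List.allFin n) k ] H (position i ∷ interp position x)
      ≡⟨ ∑-cong (List.allFin n) (λ i → ∑-tuples-cubeSum n k (H ∘ (position i ∷_))) ⟩
    ∑[ i ∈ List.allFin n ] cubeSum n k (H ∘ (position i ∷_))
      ≡⟨ ∑-allFin n (λ u → cubeSum n k (H ∘ (+ suc u ∷_))) ⟩
    cubeSum n (suc k) H
      ∎
    where open ≡-Reasoning

  isSolution : ∀ {k} → Vec ℤ k → Vec ℤ k → Bool
  isSolution a X = ⌊ linform a X ℤ.≟ 0ℤ ⌋

  isSolution-complete : ∀ {k} (a X : Vec ℤ k) → linform a X ≡ 0ℤ → isSolution a X ≡ true
  isSolution-complete a X aX≡0 with linform a X ℤ.≟ 0ℤ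
  ... | yes _    = refl
  ... | no aX≢0 = contradiction aX≡0 aX≢0

  isSolution-sound : ∀ {k} (a X : Vec ℤ k) → isSolution a X ≡ true → linform a X ≡ 0ℤ
  isSolution-sound a X isSol with linform a X ℤ.≟ 0ℤ
  ... | yes aX≡0 = aX≡0

module Hyperplane where

  open FiniteSum
  open LinearForm
  open CubeSum
  open import Data.Nat
  open import Data.Nat.Properties
  open import Data.Nat.Tactic.RingSolver using (solve-∀)
  open import Data.Integer as ℤ using (ℤ; +_; -[1+_]; ∣_∣; 0ℤ; 1ℤ)
  import Data.Integer.Properties as ℤ
  import Data.Integer.Tactic.RingSolver as ℤ
  import Data.Fin as Fin
  open import Algebra.Bundles using (AbelianGroup)
  open import Algebra.Properties.Group (AbelianGroup.group ℤ.+-0-abelianGroup) using (∙-cancelʳ)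

  module _ (n : ℕ) (h : ℤ → ℕ) {B : ℕ} (h≤B : ∀ y → h y ≤ B) where

    private
      shifted : ℤ → ℕ
      shifted d = lineSum n (λ y → h (y ℤ.+ d))

      shifted-suc : ∀ d → h (1ℤ ℤ.+ d) + shifted (ℤ.suc d) ≡ shifted d + h (+ suc n ℤ.+ d)
      shifted-suc d = trans (cong (_+_ (h (1ℤ ℤ.+ d))) (∑<-cong n (λ u _ → cong h (reassoc (+ suc u) d))))
                            (∑<-snoc n (λ u → h (+ suc u ℤ.+ d)))
        where
        reassoc : ∀ x d → x ℤ.+ (1ℤ ℤ.+ d) ≡ (1ℤ ℤ.+ x) ℤ.+ d
        reassoc = ℤ.solve-∀

      shifted-up : ∀ d → shifted (ℤ.suc d) ≤ shifted d + B
      shifted-up d = begin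
        shifted (ℤ.suc d)                             ≤⟨ m≤n+m _ (h (1ℤ ℤ.+ d)) ⟩
        h (1ℤ ℤ.+ d) + shifted (ℤ.suc d)              ≡⟨ shifted-suc d ⟩
        shifted d + h (+ suc n ℤ.+ d)                 ≤⟨ +-monoʳ-≤ (shifted d) (h≤B _) ⟩
        shifted d + B                                 ∎
        where open ≤-Reasoning

      shifted-down : ∀ d → shifted d ≤ shifted (ℤ.suc d) + B
      shifted-down d = begin
        shifted d                                     ≤⟨ m≤m+n _ (h (+ suc n ℤ.+ d)) ⟩
        shifted d + h (+ suc n ℤ.+ d)                 ≡⟨ shifted-suc d ⟨
        h (1ℤ ℤ.+ d) + shifted (ℤ.suc d)              ≤⟨ +-monoˡ-≤ _ (h≤B _) ⟩
        B + shifted (ℤ.suc d)                         ≡⟨ +-comm B _ ⟩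
        shifted (ℤ.suc d) + B                         ∎
        where open ≤-Reasoning

      +-swap : ∀ a b c → a + b + c ≡ a + (c + b)
      +-swap = solve-∀

      shifted-≤ : ∀ d → shifted d ≤ shifted 0ℤ + ∣ d ∣ * B
      shifted-≤ (+ zero)     = m≤m+n _ 0
      shifted-≤ (+ suc j)    = ≤-trans (shifted-up (+ j))
        (≤-trans (+-monoˡ-≤ B (shifted-≤ (+ j))) (≤-reflexive (+-swap (shifted 0ℤ) (j * B) B)))
      shifted-≤ -[1+ zero ]  = ≤-trans (shifted-down -[1+ 0 ])
        (≤-reflexive (cong (_+_ (shifted 0ℤ)) (sym (+-identityʳ B))))
      shifted-≤ -[1+ suc j ] = ≤-trans (shifted-down -[1+ suc j ])
        (≤-trans (+-monoˡ-≤ B (shifted-≤ -[1+ j ])) (≤-reflexive (+-swap (shifted 0ℤ) (suc j * B) B)))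

    lineSum-shift : ∀ d → lineSum n (λ y → h (y ℤ.+ d)) ≤ lineSum n h + ∣ d ∣ * B
    lineSum-shift d = subst (λ s → shifted d ≤ s + ∣ d ∣ * B)
                            (∑<-cong n (λ u _ → cong h (ℤ.+-identityʳ (+ suc u)))) (shifted-≤ d)

  AllNonZero : ∀ {k} → Vec ℤ k → Set
  AllNonZero a = ∀ i → lookup a i ≢ 0ℤ

  OnHyperplane : ∀ {k} → Vec ℤ k → ℤ → (Vec ℤ k → Bool) → Set
  OnHyperplane a c F = ∀ X → F X ≡ true → linform a X ℤ.+ c ≡ 0ℤ

  OnHyperplane-slice : ∀ {k} a (as : Vec ℤ k) {c F} → OnHyperplane (a ∷ as) c F →
                       ∀ y → OnHyperplane as (a ℤ.* y ℤ.+ c) (F ∘ (y ∷_))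
  OnHyperplane-slice a as {c} onF y X FyX = trans (reassoc (a ℤ.* y) (linform as X) c) (onF (y ∷ X) FyX)
    where
    reassoc : ∀ p q c → q ℤ.+ (p ℤ.+ c) ≡ (p ℤ.+ q) ℤ.+ c
    reassoc = ℤ.solve-∀

  lineSum-≤1 : ∀ n (P : ℤ → Bool) → (∀ {y y′} → P y ≡ true → P y′ ≡ true → y ≡ y′) → lineSum n (𝟙 ∘ P) ≤ 1
  lineSum-≤1 n P unique = ∑<-≤1 n (P ∘ +_ ∘ suc) (λ u v Pu Pv → suc-injective (ℤ.+-injective (unique Pu Pv)))

  hyperplane-count-≤ : ∀ n k (a : Vec ℤ (suc k)) c F → AllNonZero a → OnHyperplane a c F →
                       cubeSum n (suc k) (𝟙 ∘ F) ≤ n ^ k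
  hyperplane-count-≤ n zero (a ∷ []) c F a≢0 onF = lineSum-≤1 n (F ∘ (_∷ [])) (λ Fy Fy′ →
    solution-unique a c (a≢0 Fin.zero) (on-line Fy) (on-line Fy′))
    where
    on-line : ∀ {y} → F (y ∷ []) ≡ true → a ℤ.* y ℤ.+ c ≡ 0ℤ
    on-line {y} Fy = trans (cong (ℤ._+ c) (sym (ℤ.+-identityʳ (a ℤ.* y)))) (onF (y ∷ []) Fy)
  hyperplane-count-≤ n (suc k) (a ∷ as) c F a≢0 onF = ∑<-≤-const n (λ u →
    hyperplane-count-≤ n k as _ _ (a≢0 ∘ Fin.suc) (OnHyperplane-slice a as onF (+ suc u)))

  -- In the plane each row and each column of [1,n]² contains at most one point of F; in higher dimension
  -- the first coordinate is shifted against the slice bound of hyperplane-count-≤.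
  hyperplane-shift-≤ : ∀ n k (a : Vec ℤ (2 + k)) c F (D : Vec ℤ (2 + k)) → AllNonZero a → OnHyperplane a c F →
                       cubeSum n (2 + k) (λ X → 𝟙 (F (X +ᵛ D))) ≤ cubeSum n (2 + k) (𝟙 ∘ F) + ∥ D ∥₁ * n ^ k
  hyperplane-shift-≤ n zero (a₁ ∷ a₂ ∷ []) c F (d₁ ∷ d₂ ∷ []) a≢0 onF = begin
    lineSum n (λ y → h (y ℤ.+ d₁))                 ≤⟨ lineSum-shift n h h≤1 d₁ ⟩
    lineSum n h + ∣ d₁ ∣ * 1                       ≡⟨ cong (_+ ∣ d₁ ∣ * 1) (∑<-comm n n _) ⟩
    lineSum n (λ z → g (z ℤ.+ d₂)) + ∣ d₁ ∣ * 1    ≤⟨ +-monoˡ-≤ (∣ d₁ ∣ * 1) (lineSum-shift n g g≤1 d₂) ⟩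
    lineSum n g + ∣ d₂ ∣ * 1 + ∣ d₁ ∣ * 1          ≡⟨ cong (λ s → s + ∣ d₂ ∣ * 1 + ∣ d₁ ∣ * 1) (∑<-comm n n _) ⟩
    cubeSum n 2 (𝟙 ∘ F) + ∣ d₂ ∣ * 1 + ∣ d₁ ∣ * 1  ≡⟨ regroup (cubeSum n 2 (𝟙 ∘ F)) ∣ d₁ ∣ ∣ d₂ ∣ ⟩
    cubeSum n 2 (𝟙 ∘ F) + ∥ d₁ ∷ d₂ ∷ [] ∥₁ * 1    ∎
    where
    open ≤-Reasoning
    regroup : ∀ s x y → s + y * 1 + x * 1 ≡ s + (x + (y + 0)) * 1
    regroup = solve-∀
    h g : ℤ → ℕ
    h y = lineSum n (λ z → 𝟙 (F (y ∷ z ℤ.+ d₂ ∷ [])))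
    g z = lineSum n (λ y → 𝟙 (F (y ∷ z ∷ [])))
    on-row : ∀ {y w} → F (y ∷ w ∷ []) ≡ true → a₂ ℤ.* w ℤ.+ (a₁ ℤ.* y ℤ.+ c) ≡ 0ℤ
    on-row {y} {w} F≡true = trans (reassoc (a₁ ℤ.* y) (a₂ ℤ.* w) c) (onF _ F≡true)
      where
      reassoc : ∀ p q c → q ℤ.+ (p ℤ.+ c) ≡ (p ℤ.+ (q ℤ.+ 0ℤ)) ℤ.+ c
      reassoc = ℤ.solve-∀
    on-column : ∀ {y w} → F (y ∷ w ∷ []) ≡ true → a₁ ℤ.* y ℤ.+ (a₂ ℤ.* w ℤ.+ 0ℤ ℤ.+ c) ≡ 0ℤ
    on-column {y} F≡true = trans (sym (ℤ.+-assoc (a₁ ℤ.* y) _ c)) (onF _ F≡true)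
    h≤1 : ∀ y → h y ≤ 1
    h≤1 y = lineSum-≤1 n (λ z → F (y ∷ z ℤ.+ d₂ ∷ [])) (λ {z} {z′} Fz Fz′ →
      ∙-cancelʳ d₂ z z′ (solution-unique a₂ _ (a≢0 (Fin.suc Fin.zero)) (on-row {y} Fz) (on-row {y} Fz′)))
    g≤1 : ∀ z → g z ≤ 1
    g≤1 z = lineSum-≤1 n (λ y → F (y ∷ z ∷ [])) (λ Fy Fy′ →
      solution-unique a₁ _ (a≢0 Fin.zero) (on-column {w = z} Fy) (on-column {w = z} Fy′))
  hyperplane-shift-≤ n (suc k) (a ∷ as) c F (d ∷ D) a≢0 onF = begin
    lineSum n (λ y → cubeSum n (2 + k) (λ X → 𝟙 (F (y ℤ.+ d ∷ X +ᵛ D))))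
      ≤⟨ ∑<-mono n (λ u _ → hyperplane-shift-≤ n k as _ _ D (a≢0 ∘ Fin.suc) (OnHyperplane-slice a as onF _)) ⟩
    lineSum n (λ y → H (y ℤ.+ d) + ∥ D ∥₁ * n ^ k)
      ≡⟨ trans (∑<-+ n _ _) (cong (_+_ (lineSum n (λ y → H (y ℤ.+ d)))) (∑<-const n _)) ⟩
    lineSum n (λ y → H (y ℤ.+ d)) + n * (∥ D ∥₁ * n ^ k)
      ≤⟨ +-monoˡ-≤ _ (lineSum-shift n H H≤ d) ⟩
    lineSum n H + ∣ d ∣ * (n * n ^ k) + n * (∥ D ∥₁ * n ^ k)
      ≡⟨ regroup (lineSum n H) ∣ d ∣ n ∥ D ∥₁ (n ^ k) ⟩
    lineSum n H + (∣ d ∣ + ∥ D ∥₁) * (n * n ^ k)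
      ∎
    where
    open ≤-Reasoning
    regroup : ∀ s x n y p → s + x * (n * p) + n * (y * p) ≡ s + (x + y) * (n * p)
    regroup = solve-∀
    H : ℤ → ℕ
    H y = cubeSum n (2 + k) (𝟙 ∘ F ∘ (y ∷_))
    H≤ : ∀ y → H y ≤ n * n ^ k
    H≤ y = hyperplane-count-≤ n (suc k) as _ _ (a≢0 ∘ Fin.suc) (OnHyperplane-slice a as onF y)

module LowerBound where

  open FiniteSum
  open LinearForm
  open CubeSum
  open Hyperplane using (AllNonZero)
  open import Data.Nat
  open import Data.Nat.Properties
  open import Data.Nat.Tactic.RingSolver using (solve-∀)
  open import Data.Nat.DivMod using (_/_; _%_; m*n/n≡m; /-monoˡ-≤; m/n*n≤m; m≡m%n+[m/n]*n; m%n<n)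
  open import Data.Integer as ℤ using (ℤ; +_; -[1+_]; ∣_∣; 0ℤ)
  import Data.Integer.Properties as ℤ
  import Data.Integer.Tactic.RingSolver as ℤ
  import Data.Fin as Fin
  open import Algebra.Properties.CommutativeSemigroup *-commutativeSemigroup using () renaming (interchange to *-interchange)

  stride : ℕ → ℕ → ℕ → ℤ
  stride α β s = + suc (β + s * α)

  cubeSum-≥-grid : ∀ n w α k (βs : Vec ℕ k) (G : Vec ℤ k → ℕ) → 1 ≤ α → (∀ i → lookup βs i + w * α ≤ n) →
                   (∀ t → (∀ i → lookup t i < w) → 1 ≤ G (Vec.zipWith (stride α) βs t)) → w ^ k ≤ cubeSum n k G
  cubeSum-≥-grid n w α zero    []       G _   _   G≥1 = G≥1 [] (λ ())
  cubeSum-≥-grid n w α (suc k) (β ∷ βs) G 1≤α βs≤ G≥1 = begin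
    w * w ^ k
      ≡⟨ ∑<-const w (w ^ k) ⟨
    ∑[ s < w ] w ^ k
      ≤⟨ ∑<-mono w (λ s s<w → cubeSum-≥-grid n w α k βs _ 1≤α (βs≤ ∘ Fin.suc)
                                (λ t t<w → G≥1 (s ∷ t) λ { Fin.zero → s<w ; (Fin.suc i) → t<w i })) ⟩
    ∑[ s < w ] cubeSum n k (G ∘ (stride α β s ∷_))
      ≤⟨ ∑<-stride-≤ β w α (λ u → cubeSum n k (G ∘ (+ suc u ∷_))) 1≤α (βs≤ Fin.zero) ⟩
    cubeSum n (suc k) G
      ∎
    where open ≤-Reasoning

  stride-pred : ∀ N α x s → 1 ≤ N * x → stride α (pred (N * x)) s ≡ + N ℤ.* + x ℤ.+ + α ℤ.* + s
  stride-pred N α x s 1≤Nx = begin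
    + suc (pred (N * x) + s * α)  ≡⟨ cong (λ m → + (m + s * α)) (suc-pred (N * x) {{>-nonZero 1≤Nx}}) ⟩
    + (N * x + s * α)             ≡⟨ cong (λ m → + (N * x + m)) (*-comm s α) ⟩
    + (N * x + α * s)             ≡⟨ ℤ.pos-+ (N * x) (α * s) ⟩
    + (N * x) ℤ.+ + (α * s)       ≡⟨ cong₂ ℤ._+_ (ℤ.pos-* N x) (ℤ.pos-* α s) ⟩
    + N ℤ.* + x ℤ.+ + α ℤ.* + s   ∎
    where open ≡-Reasoning

  linform-stride : ∀ {k} (a : Vec ℤ k) N α (xs t : Vec ℕ k) → (∀ i → 1 ≤ N * lookup xs i) →
    linform a (Vec.zipWith (stride α) (Vec.map (λ x → pred (N * x)) xs) t)
      ≡ + N ℤ.* linform a (Vec.map +_ xs) ℤ.+ + α ℤ.* linform a (Vec.map +_ t)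
  linform-stride []       N α []       []      _     = sym (cong₂ ℤ._+_ (ℤ.*-zeroʳ (+ N)) (ℤ.*-zeroʳ (+ α)))
  linform-stride (a ∷ as) N α (x ∷ xs) (s ∷ t) 1≤Nx =
    trans (cong₂ (λ p q → a ℤ.* p ℤ.+ q) (stride-pred N α x s (1≤Nx Fin.zero)) (linform-stride as N α xs t (1≤Nx ∘ Fin.suc)))
          (regroup a (+ N) (+ α) (+ x) (+ s) _ _)
    where
    regroup : ∀ a N α x s p q → a ℤ.* (N ℤ.* x ℤ.+ α ℤ.* s) ℤ.+ (N ℤ.* p ℤ.+ α ℤ.* q)
                                  ≡ N ℤ.* (a ℤ.* x ℤ.+ p) ℤ.+ α ℤ.* (a ℤ.* s ℤ.+ q)
    regroup = ℤ.solve-∀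

  offset-in-range : ∀ {M B n} ℓ → ∣ ℓ ∣ ≤ B → B < M → M + B ≤ n → ∃ λ u → + M ℤ.- ℓ ≡ + suc u × u < n
  offset-in-range {M} {B} {n} (+ j) j≤B B<M M+B≤n = M ∸ suc j , M-j≡ , ≤-trans (≤-reflexive (sym M-j≡suc)) M-j≤n
    where
    j<M : j < M
    j<M = ≤-<-trans j≤B B<M
    M-j≡suc : M ∸ j ≡ suc (M ∸ suc j)
    M-j≡suc = +-∸-assoc 1 j<M
    M-j≡ : + M ℤ.- + j ≡ + suc (M ∸ suc j)
    M-j≡ = trans (ℤ.m-n≡m⊖n M j) (trans (ℤ.⊖-≥ (<⇒≤ j<M)) (cong +_ M-j≡suc))
    M-j≤n : M ∸ j ≤ n
    M-j≤n = ≤-trans (m∸n≤m M j) (≤-trans (m≤m+n M B) M+B≤n)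
  offset-in-range {M} {B} {n} -[1+ j ] j<B B<M M+B≤n =
    M + j , cong +_ (+-suc M j) , ≤-trans (≤-reflexive (sym (+-suc M j))) (≤-trans (+-monoʳ-≤ M j<B) M+B≤n)

  gridScale : ∀ {k} → Vec ℤ k → ℕ
  gridScale a = suc ∥ a ∥₁ * suc (posWeight a + negWeight a)

  -- With (x₁, x′) the balanced solution and N = 1 + ∥a∥₁ w, every t ∈ [0,w)^k yields the solution
  -- (N x₁ − sign(a₁) (a′·t), N x′ + |a₁| t) of a·X = 0, and these distinct solutions lie in [1,n]^(k+1).
  solutionCount-≥ : ∀ {k} n w (a : Vec ℤ (suc k)) → AllNonZero a → 1 ≤ posWeight a → 1 ≤ negWeight a →
                    1 ≤ w → w * gridScale a ≤ n → w ^ k ≤ cubeSum n (suc k) (𝟙 ∘ isSolution a)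
  solutionCount-≥ {k} n w a@(a₁ ∷ as) a≢0 1≤P 1≤Q (s≤s {n = w′} _) w·scale≤n =
    ≤-trans (cubeSum-≥-grid n w α k βs G 1≤α βs-fit G≥1)
            (≤-reflexive (cubeSum-lineSum n k n (λ V y → 𝟙 (isSolution a (y ∷ V)))))
    where
    P Q A α N : ℕ
    P = posWeight a
    Q = negWeight a
    A = ∥ a ∥₁
    α = ∣ a₁ ∣
    N = suc (A * w)
    x₁ = balance P Q a₁
    xs = Vec.map (balance P Q) as
    βs = Vec.map (λ x → pred (N * x)) xs

    G : Vec ℤ k → ℕ
    G V = lineSum n (λ y → 𝟙 (isSolution a (y ∷ V)))

    1≤α : 1 ≤ α
    1≤α = n≢0⇒n>0 (a≢0 Fin.zero ∘ ℤ.∣i∣≡0⇒i≡0)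

    room : N * (P + Q) + A * w ≤ n
    room = ≤-trans (≤-trans (m≤m+n _ (suc w′ + w′ * (P + Q))) (≤-reflexive (expand w′ A (P + Q)))) w·scale≤n
      where
      expand : ∀ w′ A X → suc (A * suc w′) * X + A * suc w′ + (suc w′ + w′ * X) ≡ suc w′ * (suc A * suc X)
      expand = solve-∀

    Nx≤ : ∀ x → N * balance P Q x ≤ N * (P + Q)
    Nx≤ x = *-monoʳ-≤ N (proj₂ (balance-bounds x 1≤P 1≤Q))

    1≤Nx : ∀ i → 1 ≤ N * lookup xs i
    1≤Nx i rewrite Vecₚ.lookup-map i (balance P Q) as = *-mono-≤ (m≤m+n 1 (A * w)) (proj₁ (balance-bounds (lookup as i) 1≤P 1≤Q))

    βs-fit : ∀ i → lookup βs i + w * α ≤ n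
    βs-fit i rewrite Vecₚ.lookup-map i (λ x → pred (N * x)) xs | Vecₚ.lookup-map i (balance P Q) as =
      ≤-trans (+-mono-≤ (≤-trans (m∸n≤m _ 1) (Nx≤ (lookup as i)))
                        (≤-trans (≤-reflexive (*-comm w α)) (*-monoˡ-≤ w (m≤m+n α ∥ as ∥₁)))) room

    G≥1 : ∀ t → (∀ i → lookup t i < w) → 1 ≤ G (Vec.zipWith (stride α) βs t)
    G≥1 t t<w = ≤-trans (≤-reflexive (cong 𝟙 (sym isSol))) (∑<-≥-term n _ u<n)
      where
      ℓ  = linform as (Vec.map +_ t)
      ℓ′ = withSignOf a₁ ℓ
      B  = ∥ as ∥₁ * w
      M  = N * x₁
      B<M : B < M
      B<M = ≤-trans (s≤s (*-monoˡ-≤ w (m≤n+m ∥ as ∥₁ α))) (m≤m*n N x₁ {{>-nonZero (proj₁ (balance-bounds a₁ 1≤P 1≤Q))}})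
      M+B≤n : M + B ≤ n
      M+B≤n = ≤-trans (+-mono-≤ (Nx≤ a₁) (*-monoˡ-≤ w (m≤n+m ∥ as ∥₁ α))) room
      ∣ℓ′∣≤B : ∣ ℓ′ ∣ ≤ B
      ∣ℓ′∣≤B = ≤-trans (≤-reflexive (∣withSignOf∣ a₁ ℓ)) (∣linform∣≤ as t w (<⇒≤ ∘ t<w))
      y-in-range = offset-in-range ℓ′ ∣ℓ′∣≤B B<M M+B≤n
      u = proj₁ y-in-range
      u<n = proj₂ (proj₂ y-in-range)
      isSol : isSolution a (+ suc u ∷ Vec.zipWith (stride α) βs t) ≡ true
      isSol = isSolution-complete a _ (begin
        a₁ ℤ.* + suc u ℤ.+ linform as (Vec.zipWith (stride α) βs t)
          ≡⟨ cong₂ (λ y L → a₁ ℤ.* y ℤ.+ L) (trans (sym (proj₁ (proj₂ y-in-range))) (cong (ℤ._- ℓ′) (ℤ.pos-* N x₁)))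
                                             (linform-stride as N α xs t 1≤Nx) ⟩
        a₁ ℤ.* (+ N ℤ.* + x₁ ℤ.- ℓ′) ℤ.+ (+ N ℤ.* linform as (Vec.map +_ xs) ℤ.+ + α ℤ.* ℓ)
          ≡⟨ regroup a₁ (+ N) (+ x₁) _ ℓ′ (+ α ℤ.* ℓ) ⟩
        + N ℤ.* linform a (Vec.map +_ (balanced a)) ℤ.+ (+ α ℤ.* ℓ ℤ.- a₁ ℤ.* ℓ′)
          ≡⟨ cong₂ (λ p q → + N ℤ.* p ℤ.+ (+ α ℤ.* ℓ ℤ.- q)) (linform-balanced a) (*-withSignOf a₁ ℓ) ⟩
        + N ℤ.* 0ℤ ℤ.+ (+ α ℤ.* ℓ ℤ.- + α ℤ.* ℓ)
          ≡⟨ vanish (+ N) (+ α ℤ.* ℓ) ⟩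
        0ℤ ∎)
        where
        open ≡-Reasoning
        regroup : ∀ a N x L ℓ′ αℓ → a ℤ.* (N ℤ.* x ℤ.- ℓ′) ℤ.+ (N ℤ.* L ℤ.+ αℓ)
                                      ≡ N ℤ.* (a ℤ.* x ℤ.+ L) ℤ.+ (αℓ ℤ.- a ℤ.* ℓ′)
        regroup = ℤ.solve-∀
        vanish : ∀ N p → N ℤ.* 0ℤ ℤ.+ (p ℤ.- p) ≡ 0ℤ
        vanish = ℤ.solve-∀

  private
    *-distrib-^ : ∀ x y k → (x * y) ^ k ≡ x ^ k * y ^ k
    *-distrib-^ x y zero    = refl
    *-distrib-^ x y (suc k) = trans (cong (x * y *_) (*-distrib-^ x y k)) (*-interchange x y (x ^ k) (y ^ k))

  -- With w = ⌊n / Z⌋ for Z = gridScale a, the count is at least w^(k+1), and n ≤ 2 Z w.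
  solutionCount-dominates : ∀ {k} (a : Vec ℤ (2 + k)) → AllNonZero a → 1 ≤ posWeight a → 1 ≤ negWeight a →
                            ∀ C → ∃ λ N₀ → ∀ n → N₀ ≤ n → C * n ^ k < cubeSum n (2 + k) (𝟙 ∘ isSolution a)
  solutionCount-dominates {k} a a≢0 1≤P 1≤Q C = suc E * Z , dominates
    where
    Z = gridScale a
    E = C * (2 * Z) ^ k
    dominates : ∀ n → suc E * Z ≤ n → C * n ^ k < cubeSum n (2 + k) (𝟙 ∘ isSolution a)
    dominates n N₀≤n = begin-strict
      C * n ^ k               ≤⟨ *-monoʳ-≤ C (^-monoˡ-≤ k n≤2Zw) ⟩
      C * (2 * Z * w) ^ k     ≡⟨ cong (C *_) (*-distrib-^ (2 * Z) w k) ⟩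
      C * ((2 * Z) ^ k * w ^ k) ≡⟨ *-assoc C _ _ ⟨
      E * w ^ k               <⟨ m<n+m (E * w ^ k) (m^n>0 w {{>-nonZero 1≤w}} k) ⟩
      w ^ k + E * w ^ k       ≤⟨ *-monoˡ-≤ (w ^ k) 1+E≤w ⟩
      w * w ^ k               ≤⟨ solutionCount-≥ n w a a≢0 1≤P 1≤Q 1≤w (m/n*n≤m n Z) ⟩
      cubeSum n (2 + k) (𝟙 ∘ isSolution a) ∎
      where
      open ≤-Reasoning
      w = n / Z
      1+E≤w : suc E ≤ w
      1+E≤w = ≤-trans (≤-reflexive (sym (m*n/n≡m (suc E) Z))) (/-monoˡ-≤ Z N₀≤n)
      1≤w : 1 ≤ w
      1≤w = ≤-trans (s≤s z≤n) 1+E≤w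
      n≤2Zw : n ≤ 2 * Z * w
      n≤2Zw = begin
        n                   ≡⟨ m≡m%n+[m/n]*n n Z ⟩
        n % Z + w * Z       ≤⟨ +-monoˡ-≤ (w * Z) (≤-trans (<⇒≤ (m%n<n n Z)) (m≤m*n Z w {{>-nonZero 1≤w}})) ⟩
        Z * w + w * Z       ≡⟨ double Z w ⟩
        2 * Z * w           ∎
        where
        double : ∀ Z w → Z * w + w * Z ≡ 2 * Z * w
        double = solve-∀

module Residue (m : ℕ) .{{_ : NonZero m}} where

  open LinearForm
  open import Data.Integer hiding (suc; NonZero)
  open import Data.Integer.Properties
  open import Data.Integer.Tactic.RingSolver using (solve-∀)
  open import Data.Integer.Divisibility.Signed using (_∣_; divides; ∣⇒∣ᵤ; ∣m∣n⇒∣m+n; ∣m∣n⇒∣m-n; ∣n⇒∣m*n)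
  open import Data.Integer.DivMod using (_%ℕ_; _/ℕ_; n%ℕd<d; a≡a%ℕn+[a/ℕn]*n)
  import Data.Nat as ℕ
  import Data.Nat.Properties as ℕ
  import Data.Nat.Divisibility as ℕ
  import Data.Nat.DivMod as ℕ
  import Data.Fin as Fin
  import Data.Fin.Properties as Fin
  open import Data.Vec.Relation.Unary.All using (All; []; _∷_)
  import Data.Bool as Bool
  open import Data.Unit using (tt)
  open import Relation.Nullary using (contradiction)

  private
    residue-unique : ∀ {r r′} → r ℕ.< m → r′ ℕ.< m → + m ∣ + r - + r′ → r ≡ r′
    residue-unique {r} {r′} r<m r′<m m∣r-r′ = +-injective (i-j≡0⇒i≡j (+ r) (+ r′) (∣i∣≡0⇒i≡0 ∣r-r′∣≡0))
      where
      ∣r-r′∣<m : ∣ + r - + r′ ∣ ℕ.< m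
      ∣r-r′∣<m = ℕ.≤-<-trans (ℕ.≤-trans (ℕ.≤-reflexive (cong ∣_∣ (m-n≡m⊖n r r′))) (∣m⊝n∣≤m⊔n r r′))
                             (ℕ.⊔-lub r<m r′<m)
      ∣r-r′∣≡0 : ∣ + r - + r′ ∣ ≡ 0
      ∣r-r′∣≡0 with ∣ + r - + r′ ∣ | ∣⇒∣ᵤ m∣r-r′ | ∣r-r′∣<m
      ... | ℕ.zero  | _    | _   = refl
      ... | ℕ.suc d | m∣d  | d<m = contradiction (ℕ.∣⇒≤ m∣d) (ℕ.<⇒≱ d<m)

    ∣-remainder : ∀ z → + m ∣ z - + (z %ℕ m)
    ∣-remainder z = divides (z /ℕ m) (begin
      z - + (z %ℕ m)                          ≡⟨ cong (_- + (z %ℕ m)) (a≡a%ℕn+[a/ℕn]*n z m) ⟩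
      + (z %ℕ m) + z /ℕ m * + m - + (z %ℕ m)  ≡⟨ cancel (+ (z %ℕ m)) (z /ℕ m * + m) ⟩
      z /ℕ m * + m                            ∎)
      where
      open ≡-Reasoning
      cancel : ∀ r q → r + q - r ≡ q
      cancel = solve-∀

  ∣⇒%ℕ-≡ : ∀ z z′ → + m ∣ z - z′ → z %ℕ m ≡ z′ %ℕ m
  ∣⇒%ℕ-≡ z z′ m∣z-z′ = residue-unique (n%ℕd<d z m) (n%ℕd<d z′ m)
    (subst (+ m ∣_) (regroup z z′ _ _) (∣m∣n⇒∣m-n m∣z-z′ (∣m∣n⇒∣m-n (∣-remainder z) (∣-remainder z′))))
    where
    regroup : ∀ z z′ r r′ → z - z′ - ((z - r) - (z′ - r′)) ≡ r - r′
    regroup = solve-∀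

  %ℕ-≡⇒∣ : ∀ z z′ → z %ℕ m ≡ z′ %ℕ m → + m ∣ z - z′
  %ℕ-≡⇒∣ z z′ z%m≡z′%m = subst (+ m ∣_) (regroup z z′ (+ (z %ℕ m)) (cong +_ z%m≡z′%m))
                                     (∣m∣n⇒∣m-n (∣-remainder z) (∣-remainder z′))
    where
    regroup : ∀ z z′ r {r′} → r ≡ r′ → (z - r) - (z′ - r′) ≡ z - z′
    regroup z z′ r refl = cancel z z′ r
      where
      cancel : ∀ z z′ r → (z - r) - (z′ - r) ≡ z - z′
      cancel = solve-∀

  reduce : ℤ → Fin m
  reduce z = Fin.fromℕ< (n%ℕd<d z m)

  lift : ∀ {k} → Vec (Fin m) k → Vec ℤ k
  lift = interp (λ i → + toℕ i)

  reduceᵛ : ∀ {k} → Vec ℤ k → Vec (Fin m) k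
  reduceᵛ = Vec.map reduce

  toℕ-reduce : ∀ z → toℕ (reduce z) ≡ z %ℕ m
  toℕ-reduce z = Fin.toℕ-fromℕ< (n%ℕd<d z m)

  ∣⇒reduce-≡ : ∀ z z′ → + m ∣ z - z′ → reduce z ≡ reduce z′
  ∣⇒reduce-≡ z z′ m∣z-z′ =
    Fin.toℕ-injective (trans (toℕ-reduce z) (trans (∣⇒%ℕ-≡ z z′ m∣z-z′) (sym (toℕ-reduce z′))))

  reduce-≡⇒∣ : ∀ z z′ → reduce z ≡ reduce z′ → + m ∣ z - z′
  reduce-≡⇒∣ z z′ eq = %ℕ-≡⇒∣ z z′ (trans (sym (toℕ-reduce z)) (trans (cong toℕ eq) (toℕ-reduce z′)))

  reduce-toℕ : ∀ (i : Fin m) → reduce (+ toℕ i) ≡ i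
  reduce-toℕ i = Fin.toℕ-injective (trans (toℕ-reduce (+ toℕ i)) (ℕ.m<n⇒m%n≡m (Fin.toℕ<n i)))

  reduceᵛ-lift : ∀ {k} (r : Vec (Fin m) k) → reduceᵛ (lift r) ≡ r
  reduceᵛ-lift []      = refl
  reduceᵛ-lift (i ∷ r) = cong₂ _∷_ (reduce-toℕ i) (reduceᵛ-lift r)

  All∣⇒reduceᵛ-≡ : ∀ {k} (X Y : Vec ℤ k) → All (+ m ∣_) (X -ᵛ Y) → reduceᵛ X ≡ reduceᵛ Y
  All∣⇒reduceᵛ-≡ []      []      []             = refl
  All∣⇒reduceᵛ-≡ (x ∷ X) (y ∷ Y) (m∣x-y ∷ m∣X-Y) = cong₂ _∷_ (∣⇒reduce-≡ x y m∣x-y) (All∣⇒reduceᵛ-≡ X Y m∣X-Y)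

  reduceᵛ-≡⇒All∣ : ∀ {k} (X Y : Vec ℤ k) → reduceᵛ X ≡ reduceᵛ Y → All (+ m ∣_) (X -ᵛ Y)
  reduceᵛ-≡⇒All∣ []      []      _  = []
  reduceᵛ-≡⇒All∣ (x ∷ X) (y ∷ Y) eq =
    reduce-≡⇒∣ x y (Vecₚ.∷-injectiveˡ eq) ∷ reduceᵛ-≡⇒All∣ X Y (Vecₚ.∷-injectiveʳ eq)

  All∣⇒∣linform : ∀ {k} (a V : Vec ℤ k) → All (+ m ∣_) V → + m ∣ linform a V
  All∣⇒∣linform []      []      []            = divides 0ℤ refl
  All∣⇒∣linform (a ∷ as) (v ∷ V) (m∣v ∷ m∣V) = ∣m∣n⇒∣m+n (∣n⇒∣m*n a m∣v) (All∣⇒∣linform as V m∣V)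

  private
    0%m≡0 : 0 ℕ.% m ≡ 0
    0%m≡0 = ℕ.m<n⇒m%n≡m (ℕ.>-nonZero⁻¹ m)

  solMod-sound : ∀ {k} (a : Vec ℤ k) r → solMod a m r ≡ true → + m ∣ linform a (lift r)
  solMod-sound a r isSol = subst (+ m ∣_) (+-identityʳ _)
    (%ℕ-≡⇒∣ (linform a (lift r)) 0ℤ (trans (ℕ.≡ᵇ⇒≡ _ 0 (subst Bool.T (sym isSol) tt)) (sym 0%m≡0)))

  solMod-complete : ∀ {k} (a : Vec ℤ k) r → + m ∣ linform a (lift r) → solMod a m r ≡ true
  solMod-complete a r m∣ar = subst (λ x → (x ℕ.≡ᵇ 0) ≡ true) (sym ar%m≡0) refl
    where
    ar%m≡0 : linform a (lift r) %ℕ m ≡ 0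
    ar%m≡0 = trans (∣⇒%ℕ-≡ (linform a (lift r)) 0ℤ (subst (+ m ∣_) (sym (+-identityʳ _)) m∣ar)) 0%m≡0

  solMod-reduceᵛ : ∀ {k} (a X : Vec ℤ k) → linform a X ≡ 0ℤ → solMod a m (reduceᵛ X) ≡ true
  solMod-reduceᵛ a X aX≡0 =
    solMod-complete a r (subst (+ m ∣_) (cancel (linform a X) (linform a (lift r))) (∣m∣n⇒∣m-n m∣aX m∣aX-ar))
    where
    r = reduceᵛ X
    m∣aX : + m ∣ linform a X
    m∣aX = subst (+ m ∣_) (sym aX≡0) (divides 0ℤ refl)
    m∣aX-ar : + m ∣ linform a X - linform a (lift r)
    m∣aX-ar = subst (+ m ∣_) (linform-- a X (lift r))
                    (All∣⇒∣linform a (X -ᵛ lift r) (reduceᵛ-≡⇒All∣ X (lift r) (sym (reduceᵛ-lift r))))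
    cancel : ∀ p q → p - (p - q) ≡ q
    cancel = solve-∀

module ResidueClasses (m : ℕ) .{{_ : NonZero m}} where

  open FiniteSum
  open LinearForm
  open CubeSum
  open Hyperplane
  open Residue m
  open import Data.Nat hiding (NonZero)
  open import Data.Nat.Properties
  open import Data.Integer as ℤ using (ℤ; +_; 0ℤ; 1ℤ)
  import Data.Integer.Properties as ℤ
  import Data.Integer.Tactic.RingSolver as ℤ
  open import Data.Integer.Divisibility.Signed using (_∣_; ∣m∣n⇒∣m-n; ∣m⇒∣m*n)
  import Data.Fin as Fin
  open import Data.Vec.Relation.Unary.All using (All; []; _∷_)
  open import Relation.Nullary using (Dec; does; yes; no; contradiction)
  open import Data.List.Membership.Propositional.Properties using (∈-allFin)
  open import Data.Bool.Properties using (¬-not)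

  _≟ᵛ_ : ∀ {k} (r r′ : Vec (Fin m) k) → Dec (r ≡ r′)
  _≟ᵛ_ = Vecₚ.≡-dec Fin._≟_

  residues : ∀ k → List (Vec (Fin m) k)
  residues k = tuples (List.allFin m) k

  ∑-residues-δ : ∀ k (v : Vec (Fin m) k) (c : Vec (Fin m) k → ℕ) →
                 ∑[ r ∈ residues k ] (if does (v ≟ᵛ r) then c r else 0) ≡ c v
  ∑-residues-δ zero    []      c = +-identityʳ (c [])
  ∑-residues-δ (suc k) (j ∷ v) c = begin
    ∑[ r ∈ residues (suc k) ] (if does ((j ∷ v) ≟ᵛ r) then c r else 0)
      ≡⟨ ∑-tuples (List.allFin m) k _ ⟩
    ∑[ i ∈ List.allFin m ] ∑[ r ∈ residues k ] (if does (j Fin.≟ i) ∧ does (v ≟ᵛ r) then c (i ∷ r) else 0)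
      ≡⟨ ∑-cong (List.allFin m) column ⟩
    ∑[ i ∈ List.allFin m ] (if does (j Fin.≟ i) then c (i ∷ v) else 0)
      ≡⟨ ∑-allFin-δ m j (λ i → c (i ∷ v)) ⟩
    c (j ∷ v) ∎
    where
    open ≡-Reasoning
    column : ∀ i → ∑[ r ∈ residues k ] (if does (j Fin.≟ i) ∧ does (v ≟ᵛ r) then c (i ∷ r) else 0)
                   ≡ (if does (j Fin.≟ i) then c (i ∷ v) else 0)
    column i with does (j Fin.≟ i)
    ... | true  = ∑-residues-δ k v (c ∘ (i ∷_))
    ... | false = ∑-zero (residues k)

  inClass : ∀ {k} → Vec ℤ k → Vec (Fin m) k → Vec ℤ k → Bool
  inClass a r X = does (reduceᵛ X ≟ᵛ r) ∧ isSolution a X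

  classCount : ℕ → ∀ {k} → Vec ℤ k → Vec (Fin m) k → ℕ
  classCount n {k} a r = cubeSum n k (𝟙 ∘ inClass a r)

  cubeSum-by-class : ∀ n {k} (a : Vec ℤ k) (H : Vec (Fin m) k → ℕ) →
    cubeSum n k (λ X → if isSolution a X then H (reduceᵛ X) else 0) ≡ ∑[ r ∈ residues k ] (H r * classCount n a r)
  cubeSum-by-class n {k} a H = begin
    cubeSum n k (λ X → if isSolution a X then H (reduceᵛ X) else 0)
      ≡⟨ cubeSum-cong n k (λ X → ∑-residues-δ k (reduceᵛ X) (λ r → if isSolution a X then H r else 0)) ⟨
    cubeSum n k (λ X → ∑[ r ∈ residues k ] (if does (reduceᵛ X ≟ᵛ r) then (if isSolution a X then H r else 0) else 0))
      ≡⟨ cubeSum-∑ n k (residues k) _ ⟩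
    ∑[ r ∈ residues k ] cubeSum n k (λ X → if does (reduceᵛ X ≟ᵛ r) then (if isSolution a X then H r else 0) else 0)
      ≡⟨ ∑-cong (residues k) (λ r → trans (cubeSum-cong n k (split r)) (cubeSum-*ˡ n k (H r) _)) ⟩
    ∑[ r ∈ residues k ] (H r * classCount n a r) ∎
    where
    open ≡-Reasoning
    split : ∀ r X → (if does (reduceᵛ X ≟ᵛ r) then (if isSolution a X then H r else 0) else 0) ≡ H r * 𝟙 (inClass a r X)
    split r X with does (reduceᵛ X ≟ᵛ r) | isSolution a X
    ... | true  | true  = sym (*-identityʳ (H r))
    ... | true  | false = sym (*-zeroʳ (H r))
    ... | false | _     = sym (*-zeroʳ (H r))

  inClass-sound : ∀ {k} (a : Vec ℤ k) r X → inClass a r X ≡ true → reduceᵛ X ≡ r × linform a X ≡ 0ℤ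
  inClass-sound a r X isIn with reduceᵛ X ≟ᵛ r | isSolution a X in isSol
  inClass-sound a r X _  | yes X≡r | true  = X≡r , isSolution-sound a X isSol
  inClass-sound a r X () | yes _   | false
  inClass-sound a r X () | no _    | _

  classCount-nonSolution : ∀ n {k} (a : Vec ℤ k) r → solMod a m r ≡ false → classCount n a r ≡ 0
  classCount-nonSolution n {k} a r notSol = trans (cubeSum-cong n k empty) (cubeSum-*ˡ n k 0 (λ _ → 0))
    where
    empty : ∀ X → 𝟙 (inClass a r X) ≡ 0
    empty X = cong 𝟙 (¬-not λ isIn → let X≡r , aX≡0 = inClass-sound a r X isIn in
      contradiction (trans (sym (solMod-reduceᵛ a X aX≡0)) (trans (cong (solMod a m) X≡r) notSol)) λ ())

  inClass-complete : ∀ {k} (a : Vec ℤ k) r X → reduceᵛ X ≡ r → linform a X ≡ 0ℤ → inClass a r X ≡ true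
  inClass-complete a r X X≡r aX≡0 with reduceᵛ X ≟ᵛ r
  ... | yes _   = isSolution-complete a X aX≡0
  ... | no X≢r = contradiction X≡r X≢r

  -- D = δ − (a·δ) w with δ = lift r′ − lift r: since a·w = 1 we get a·D = 0, and since a·δ ≡ 0 (mod m)
  -- we get D ≡ δ (mod m), so X ↦ X + D carries the solutions in class r to solutions in class r′.
  classShift : ∀ {k} → Vec ℤ k → Vec ℤ k → Vec (Fin m) k → Vec (Fin m) k → Vec ℤ k
  classShift a w r r′ = δ -ᵛ linform a δ ·ᵛ w
    where δ = lift r′ -ᵛ lift r

  private
    All∣-shift : ∀ {k} (X ρ ρ′ w : Vec ℤ k) c → All (+ m ∣_) (X -ᵛ ρ) → + m ∣ c →
                 All (+ m ∣_) ((X +ᵛ ((ρ′ -ᵛ ρ) -ᵛ c ·ᵛ w)) -ᵛ ρ′)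
    All∣-shift []      []      []        []      c []            m∣c = []
    All∣-shift (x ∷ X) (y ∷ ρ) (y′ ∷ ρ′) (v ∷ w) c (m∣x-y ∷ m∣X) m∣c =
      subst (+ m ∣_) (regroup x y y′ (c ℤ.* v)) (∣m∣n⇒∣m-n m∣x-y (∣m⇒∣m*n v m∣c)) ∷ All∣-shift X ρ ρ′ w c m∣X m∣c
      where
      regroup : ∀ x y y′ cv → x ℤ.- y ℤ.- cv ≡ x ℤ.+ (y′ ℤ.- y ℤ.- cv) ℤ.- y′
      regroup = ℤ.solve-∀

  classCount-shift-≤ : ∀ n {k} (a : Vec ℤ (2 + k)) w → AllNonZero a → linform a w ≡ 1ℤ → ∀ r r′ →
                       solMod a m r ≡ true → solMod a m r′ ≡ true →
                       classCount n a r ≤ classCount n a r′ + ∥ classShift a w r r′ ∥₁ * n ^ k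
  classCount-shift-≤ n {k} a w a≢0 aw≡1 r r′ r-sol r′-sol =
    ≤-trans (cubeSum-mono n (2 + k) (λ X → 𝟙-mono (moves X)))
            (hyperplane-shift-≤ n k a 0ℤ (inClass a r′) D a≢0
              (λ X isIn → trans (ℤ.+-identityʳ _) (proj₂ (inClass-sound a r′ X isIn))))
    where
    δ = lift r′ -ᵛ lift r
    c = linform a δ
    D = classShift a w r r′
    m∣c : + m ∣ c
    m∣c = subst (+ m ∣_) (sym (linform-- a (lift r′) (lift r))) (∣m∣n⇒∣m-n (solMod-sound a r′ r′-sol) (solMod-sound a r r-sol))
    aD≡0 : linform a D ≡ 0ℤ
    aD≡0 = begin
      linform a D                     ≡⟨ linform-- a δ (c ·ᵛ w) ⟩
      c ℤ.- linform a (c ·ᵛ w)        ≡⟨ cong (ℤ._-_ c) (trans (linform-· a w c) (cong (c ℤ.*_) aw≡1)) ⟩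
      c ℤ.- c ℤ.* 1ℤ                  ≡⟨ cancel c ⟩
      0ℤ                              ∎
      where
      open ≡-Reasoning
      cancel : ∀ c → c ℤ.- c ℤ.* 1ℤ ≡ 0ℤ
      cancel = ℤ.solve-∀
    moves : ∀ X → inClass a r X ≡ true → inClass a r′ (X +ᵛ D) ≡ true
    moves X isIn with inClass-sound a r X isIn
    ... | X≡r , aX≡0 = inClass-complete a r′ (X +ᵛ D)
      (trans (All∣⇒reduceᵛ-≡ (X +ᵛ D) (lift r′)
                (All∣-shift X (lift r) (lift r′) w c (reduceᵛ-≡⇒All∣ X (lift r) (trans X≡r (sym (reduceᵛ-lift r)))) m∣c))
             (reduceᵛ-lift r′))
      (trans (linform-+ a X D) (cong₂ ℤ._+_ aX≡0 aD≡0))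

  modSolutionCount : ∀ {k} → Vec ℤ k → ℕ
  modSolutionCount {k} a = ∑[ r ∈ residues k ] 𝟙 (solMod a m r)

  modMonoCount : ∀ {k} → Vec ℤ k → (Fin m → Bool) → ℕ
  modMonoCount {k} a g = ∑[ r ∈ residues k ] 𝟙 (solMod a m r ∧ mono g r)

  solutionCount : ℕ → ∀ {k} → Vec ℤ k → ℕ
  solutionCount n {k} a = ∑[ r ∈ residues k ] classCount n a r

  1≤modSolutionCount : ∀ {k} (a : Vec ℤ k) → 1 ≤ modSolutionCount a
  1≤modSolutionCount {k} a = ≤-trans (≤-reflexive (cong 𝟙 (sym zero-solves)))
    (∑-≥-∈ (residues k) (𝟙 ∘ solMod a m) (∈-tuples (List.allFin m) (reduceᵛ zeros) (λ _ → ∈-allFin _)))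
    where
    zeros = Vec.replicate k 0ℤ
    zero-solves : solMod a m (reduceᵛ zeros) ≡ true
    zero-solves = solMod-reduceᵛ a zeros (linform-zeros a)

  liftedMonoCount : ℕ → ∀ {k} → Vec ℤ k → (Fin m → Bool) → ℕ
  liftedMonoCount n {k} a g = ∑[ r ∈ residues k ] (𝟙 (mono g r) * classCount n a r)

  totalShift : ∀ {k} → Vec ℤ k → Vec ℤ k → ℕ
  totalShift {k} a w = ∑[ r ∈ residues k ] ∑[ r′ ∈ residues k ] ∥ classShift a w r r′ ∥₁

  monoCount-≤ : ∀ n {k} (a : Vec ℤ (2 + k)) w g → AllNonZero a → linform a w ≡ 1ℤ →
                modSolutionCount a * liftedMonoCount n a g ≤ modMonoCount a g * solutionCount n a + totalShift a w * n ^ k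
  monoCount-≤ n {k} a w g a≢0 aw≡1 = begin
    Tm * liftedMonoCount n a g
      ≡⟨ ∑-*ˡ R Tm _ ⟨
    ∑[ r ∈ R ] (Tm * (𝟙 (mono g r) * classCount n a r))
      ≤⟨ ∑-mono R term-≤ ⟩
    ∑[ r ∈ R ] (𝟙 (solMod a m r ∧ mono g r) * Tn + Δ r * n ^ k)
      ≡⟨ ∑-+ R _ _ ⟩
    ∑[ r ∈ R ] (𝟙 (solMod a m r ∧ mono g r) * Tn) + ∑[ r ∈ R ] (Δ r * n ^ k)
      ≡⟨ cong₂ _+_ (∑-*ʳ R _ Tn) (∑-*ʳ R Δ (n ^ k)) ⟩
    modMonoCount a g * Tn + totalShift a w * n ^ k
      ∎
    where
    open ≤-Reasoning
    R = residues (2 + k)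
    Tm = modSolutionCount a
    Tn = solutionCount n a
    Δ : Vec (Fin m) (2 + k) → ℕ
    Δ r = ∑[ r′ ∈ R ] ∥ classShift a w r r′ ∥₁

    row-≤ : ∀ r → solMod a m r ≡ true → Tm * classCount n a r ≤ Tn + Δ r * n ^ k
    row-≤ r r-sol = begin
      Tm * classCount n a r                                        ≡⟨ ∑-*ʳ R _ (classCount n a r) ⟨
      ∑[ r′ ∈ R ] (𝟙 (solMod a m r′) * classCount n a r)           ≤⟨ ∑-mono R versus ⟩
      ∑[ r′ ∈ R ] (classCount n a r′ + ∥ classShift a w r r′ ∥₁ * n ^ k) ≡⟨ ∑-+ R _ _ ⟩
      Tn + ∑[ r′ ∈ R ] (∥ classShift a w r r′ ∥₁ * n ^ k)            ≡⟨ cong (_+_ Tn) (∑-*ʳ R _ (n ^ k)) ⟩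
      Tn + Δ r * n ^ k                                             ∎
      where
      versus : ∀ r′ → 𝟙 (solMod a m r′) * classCount n a r ≤ classCount n a r′ + ∥ classShift a w r r′ ∥₁ * n ^ k
      versus r′ with solMod a m r′ in r′-sol
      ... | true  = ≤-trans (≤-reflexive (+-identityʳ _)) (classCount-shift-≤ n a w a≢0 aw≡1 r r′ r-sol r′-sol)
      ... | false = z≤n

    term-≤ : ∀ r → Tm * (𝟙 (mono g r) * classCount n a r) ≤ 𝟙 (solMod a m r ∧ mono g r) * Tn + Δ r * n ^ k
    term-≤ r with solMod a m r in r-sol | mono g r
    ... | false | mono-r = ≤-trans (≤-reflexive (trans (cong (λ s → Tm * (𝟙 mono-r * s)) (classCount-nonSolution n a r r-sol))
                                                       (trans (cong (Tm *_) (*-zeroʳ (𝟙 mono-r))) (*-zeroʳ Tm)))) z≤n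
    ... | true  | false  = ≤-trans (≤-reflexive (*-zeroʳ Tm)) z≤n
    ... | true  | true   = ≤-trans (≤-reflexive (cong (Tm *_) (+-identityʳ _)))
                                  (≤-trans (row-≤ r r-sol) (≤-reflexive (cong (_+ Δ r * n ^ k) (sym (+-identityʳ Tn)))))

module Colouring where

  open FiniteSum
  open import Data.Rational as ℚ using (ℚ; 1ℚ; _⊓_)
  import Data.Rational.Properties as ℚ
  open import Data.Sum using (_⊎_; inj₁; inj₂)
  open import Data.List.Membership.Propositional using (_∈_)
  open import Data.List.Relation.Unary.Any using (here; there)
  import Data.Bool as Bool
  open import Relation.Nullary.Decidable using (⌊_⌋)

  allCol-cong : ∀ {N k} {f f′ : Fin N → Bool} → (∀ i → f i ≡ f′ i) → ∀ b (xs : Vec (Fin N) k) → allCol f b xs ≡ allCol f′ b xs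
  allCol-cong f≗f′ b []       = refl
  allCol-cong f≗f′ b (x ∷ xs) = cong₂ (λ c d → ⌊ c Bool.≟ b ⌋ ∧ d) (f≗f′ x) (allCol-cong f≗f′ b xs)

  μf-cong : ∀ {k} N (sol : Vec (Fin N) k → Bool) {f f′ : Fin N → Bool} → (∀ i → f i ≡ f′ i) → μf N sol f ≡ μf N sol f′
  μf-cong N sol {f} {f′} f≗f′ = cong (λ M → ratio M (List.length (T N sol))) (begin
    List.length (List.filter (λ xs → mono f xs Bool.≟ true) (T N sol))   ≡⟨ length-filter (T N sol) (mono f) ⟩
    ∑[ xs ∈ T N sol ] 𝟙 (mono f xs)                                     ≡⟨ ∑-cong (T N sol) (λ xs → cong 𝟙 (mono-cong xs)) ⟩
    ∑[ xs ∈ T N sol ] 𝟙 (mono f′ xs)                                    ≡⟨ length-filter (T N sol) (mono f′) ⟨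
    List.length (List.filter (λ xs → mono f′ xs Bool.≟ true) (T N sol))  ∎)
    where
    open ≡-Reasoning
    mono-cong : ∀ xs → mono f xs ≡ mono f′ xs
    mono-cong xs = cong₂ Bool._∨_ (allCol-cong f≗f′ true xs) (allCol-cong f≗f′ false xs)

  module _ {A : Set} (h : A → ℚ) where

    minimum : List A → ℚ
    minimum = List.foldr (λ c r → h c ⊓ r) 1ℚ

    minimum-≤ : ∀ {x} xs → x ∈ xs → minimum xs ℚ.≤ h x
    minimum-≤ (y ∷ xs) (here refl) = ℚ.p⊓q≤p (h y) _
    minimum-≤ (y ∷ xs) (there x∈) = ℚ.≤-trans (ℚ.p⊓q≤q (h y) _) (minimum-≤ xs x∈)

    minimum-≤1 : ∀ xs → minimum xs ℚ.≤ 1ℚ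
    minimum-≤1 []       = ℚ.≤-refl
    minimum-≤1 (y ∷ xs) = ℚ.≤-trans (ℚ.p⊓q≤q (h y) _) (minimum-≤1 xs)

    minimum-attained : ∀ xs → minimum xs ≡ 1ℚ ⊎ ∃ λ x → minimum xs ≡ h x
    minimum-attained []       = inj₁ refl
    minimum-attained (y ∷ xs) with ℚ.⊓-sel (h y) (minimum xs)
    ... | inj₁ min≡hy = inj₂ (y , min≡hy)
    ... | inj₂ min≡rest with minimum-attained xs
    ...   | inj₁ rest≡1       = inj₁ (trans min≡rest rest≡1)
    ...   | inj₂ (x , rest≡hx) = inj₂ (x , trans min≡rest rest≡hx)

  ∈-colourings : ∀ N (c : Vec Bool N) → c ∈ tuples (true ∷ false ∷ []) N
  ∈-colourings N c = ∈-tuples _ c (λ i → bool∈ (lookup c i))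
    where
    bool∈ : ∀ b → b ∈ true ∷ false ∷ []
    bool∈ true  = here refl
    bool∈ false = there (here refl)

  μmin-≤ : ∀ {k} N (sol : Vec (Fin N) k → Bool) f → μmin N sol ℚ.≤ μf N sol f
  μmin-≤ N sol f = ℚ.≤-trans (minimum-≤ (μf N sol ∘ lookup) (tuples (true ∷ false ∷ []) N) (∈-colourings N (Vec.tabulate f)))
                             (ℚ.≤-reflexive (μf-cong N sol (Vecₚ.lookup∘tabulate f)))

  μmin-≤1 : ∀ {k} N (sol : Vec (Fin N) k → Bool) → μmin N sol ℚ.≤ 1ℚ
  μmin-≤1 N sol = minimum-≤1 (μf N sol ∘ lookup) (tuples (true ∷ false ∷ []) N)

  μmin-attained : ∀ {k} N (sol : Vec (Fin N) k → Bool) → μmin N sol ≡ 1ℚ ⊎ ∃ λ g → μmin N sol ≡ μf N sol g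
  μmin-attained N sol with minimum-attained (μf N sol ∘ lookup) (tuples (true ∷ false ∷ []) N)
  ... | inj₁ μ≡1       = inj₁ μ≡1
  ... | inj₂ (c , μ≡μc) = inj₂ (lookup c , μ≡μc)

module RationalBound where

  open import Relation.Binary.PropositionalEquality using (subst₂)
  open import Data.Nat
  open import Data.Nat.Properties
  open import Data.Nat.Tactic.RingSolver using (solve-∀)
  open import Data.Integer as ℤ using (+_; -[1+_])
  import Data.Integer.Properties as ℤ
  open import Data.Rational as ℚ using (ℚ; 0ℚ; mkℚ; ↧ₙ_)
  import Data.Rational.Properties as ℚ
  import Data.Rational.Unnormalised as ℚᵘ
  import Data.Rational.Unnormalised.Properties as ℚᵘ

  -- With q the denominator of ε > 0 we have 1/q ≤ ε, and the hypothesis says M/T ≤ M′/T′ + 1/q.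
  ratio-≤-+ : ∀ M T M′ T′ (ε : ℚ) → 0ℚ ℚ.< ε → 1 ≤ T → 1 ≤ T′ →
              T′ * M * ↧ₙ ε ≤ M′ * T * ↧ₙ ε + T * T′ → ratio M T ℚ.≤ ratio M′ T′ ℚ.+ ε
  ratio-≤-+ M T M′ T′ (mkℚ (+ zero)   _ _) (ℚ.*<* (ℤ.+<+ ()))
  ratio-≤-+ M T M′ T′ (mkℚ -[1+ _ ]   _ _) (ℚ.*<* ())
  ratio-≤-+ M T@(suc T-1) M′ T′@(suc T′-1) ε@(mkℚ (+ suc e) q-1 _) _ _ _ T′Mq≤ =
    ℚ.toℚᵘ-cancel-≤ (ℚᵘ.≤-respˡ-≃ lhs≃ (ℚᵘ.≤-respʳ-≃ rhs≃ (ℚᵘ.*≤* cross-≤ℤ)))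
    where
    q = suc q-1
    lhs≃ : ℚᵘ.mkℚᵘ (+ M) T-1 ℚᵘ.≃ ℚ.toℚᵘ (ratio M T)
    lhs≃ = ℚᵘ.≃-sym (ℚ.toℚᵘ-fromℚᵘ (ℚᵘ.mkℚᵘ (+ M) T-1))
    rhs≃ : ℚᵘ.mkℚᵘ (+ M′) T′-1 ℚᵘ.+ ℚ.toℚᵘ ε ℚᵘ.≃ ℚ.toℚᵘ (ratio M′ T′ ℚ.+ ε)
    rhs≃ = ℚᵘ.≃-sym (ℚᵘ.≃-trans (ℚ.toℚᵘ-homo-+ (ratio M′ T′) ε)
                                (ℚᵘ.+-congˡ (ℚ.toℚᵘ ε) (ℚ.toℚᵘ-fromℚᵘ (ℚᵘ.mkℚᵘ (+ M′) T′-1))))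
    cross-≤ : M * (T′ * q) ≤ (M′ * q + suc e * T′) * T
    cross-≤ = begin
      M * (T′ * q)                  ≡⟨ reorder M T′ q ⟩
      T′ * M * q                    ≤⟨ T′Mq≤ ⟩
      M′ * T * q + T * T′           ≤⟨ +-monoʳ-≤ (M′ * T * q) (≤-trans (≤-reflexive (*-comm T T′))
                                                                        (*-monoˡ-≤ T (m≤n*m T′ (suc e)))) ⟩
      M′ * T * q + suc e * T′ * T   ≡⟨ factor M′ T q (suc e) T′ ⟩
      (M′ * q + suc e * T′) * T     ∎
      where
      open ≤-Reasoning
      reorder : ∀ M T′ q → M * (T′ * q) ≡ T′ * M * q
      reorder = solve-∀
      factor : ∀ M′ T q s T′ → M′ * T * q + s * T′ * T ≡ (M′ * q + s * T′) * T
      factor = solve-∀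
    cross-≤ℤ : + M ℤ.* + (T′ * q) ℤ.≤ (+ M′ ℤ.* + q ℤ.+ + suc e ℤ.* + T′) ℤ.* + T
    cross-≤ℤ = subst₂ ℤ._≤_ (ℤ.pos-* M (T′ * q))
      (trans (ℤ.pos-* (M′ * q + suc e * T′) T)
             (cong (ℤ._* + T) (trans (ℤ.pos-+ (M′ * q) (suc e * T′)) (cong₂ ℤ._+_ (ℤ.pos-* M′ q) (ℤ.pos-* (suc e) T′)))))
      (ℤ.+≤+ cross-≤)

module Density (m : ℕ) .{{_ : NonZero m}} where

  open FiniteSum
  open LinearForm
  open CubeSum
  open Hyperplane using (AllNonZero)
  open LowerBound using (solutionCount-dominates)
  open Residue m
  open ResidueClasses m
  open RationalBound
  open import Data.Nat hiding (NonZero)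
  open import Data.Nat.Properties
  open import Data.Nat.Tactic.RingSolver using (solve-∀)
  open import Data.Integer using (ℤ; 1ℤ)
  open import Data.Rational as ℚ using (0ℚ; ↧ₙ_)
  import Data.Bool as Bool

  liftColouring : ∀ {n} → (Fin m → Bool) → Fin n → Bool
  liftColouring g i = g (reduce (position i))

  private
    allCol-lift : ∀ {n k} g b (xs : Vec (Fin n) k) → allCol (liftColouring g) b xs ≡ allCol g b (reduceᵛ (interp position xs))
    allCol-lift g b []       = refl
    allCol-lift g b (x ∷ xs) = cong (_ ∧_) (allCol-lift g b xs)

    mono-lift : ∀ {n k} g (xs : Vec (Fin n) k) → mono (liftColouring g) xs ≡ mono g (reduceᵛ (interp position xs))
    mono-lift g xs = cong₂ Bool._∨_ (allCol-lift g true xs) (allCol-lift g false xs)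

  cubeSum-solutions : ∀ n {k} (a : Vec ℤ k) → cubeSum n k (𝟙 ∘ isSolution a) ≡ solutionCount n a
  cubeSum-solutions n {k} a = trans (cubeSum-by-class n a (λ _ → 1)) (∑-cong (residues k) (λ r → *-identityˡ _))

  length-T-solInt : ∀ n {k} (a : Vec ℤ k) → List.length (T n (solInt a n)) ≡ solutionCount n a
  length-T-solInt n {k} a = begin
    List.length (T n (solInt a n))                                      ≡⟨ length-filter (tuples (List.allFin n) k) (solInt a n) ⟩
    ∑[ xs ∈ tuples (List.allFin n) k ] 𝟙 (isSolution a (interp position xs)) ≡⟨ ∑-tuples-cubeSum n k (𝟙 ∘ isSolution a) ⟩
    cubeSum n k (𝟙 ∘ isSolution a)                                     ≡⟨ cubeSum-solutions n a ⟩
    solutionCount n a                                                   ∎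
    where open ≡-Reasoning

  length-mono-solInt : ∀ n {k} (a : Vec ℤ k) g →
    List.length (List.filter (λ xs → mono (liftColouring g) xs Bool.≟ true) (T n (solInt a n))) ≡ liftedMonoCount n a g
  length-mono-solInt n {k} a g = begin
    List.length (List.filter (λ xs → mono (liftColouring g) xs Bool.≟ true) (T n (solInt a n)))
      ≡⟨ length-filter (T n (solInt a n)) _ ⟩
    ∑[ xs ∈ T n (solInt a n) ] 𝟙 (mono (liftColouring g) xs)
      ≡⟨ ∑-filter (tuples (List.allFin n) k) (solInt a n) _ ⟩
    ∑[ xs ∈ tuples (List.allFin n) k ] (if solInt a n xs then 𝟙 (mono (liftColouring g) xs) else 0)
      ≡⟨ ∑-cong (tuples (List.allFin n) k) (λ xs → cong (λ b → if solInt a n xs then 𝟙 b else 0) (mono-lift g xs)) ⟩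
    ∑[ xs ∈ tuples (List.allFin n) k ] H (interp position xs)
      ≡⟨ ∑-tuples-cubeSum n k H ⟩
    cubeSum n k H
      ≡⟨ cubeSum-by-class n a (𝟙 ∘ mono g) ⟩
    liftedMonoCount n a g
      ∎
    where
    open ≡-Reasoning
    H : Vec ℤ k → ℕ
    H X = if isSolution a X then 𝟙 (mono g (reduceᵛ X)) else 0

  μf-lifted : ∀ n {k} (a : Vec ℤ k) g → μf n (solInt a n) (liftColouring g) ≡ ratio (liftedMonoCount n a g) (solutionCount n a)
  μf-lifted n a g = cong₂ ratio (length-mono-solInt n a g) (length-T-solInt n a)

  μf-residues : ∀ {k} (a : Vec ℤ k) g → μf m (solMod a m) g ≡ ratio (modMonoCount a g) (modSolutionCount a)
  μf-residues {k} a g = cong₂ ratio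
    (trans (length-filter (T m (solMod a m)) (mono g))
           (trans (∑-filter (residues k) (solMod a m) (𝟙 ∘ mono g)) (∑-cong (residues k) if-𝟙)))
    (length-filter (residues k) (solMod a m))
    where
    if-𝟙 : ∀ r → (if solMod a m r then 𝟙 (mono g r) else 0) ≡ 𝟙 (solMod a m r ∧ mono g r)
    if-𝟙 r with solMod a m r
    ... | true  = refl
    ... | false = refl

  density-≤ : ∀ n {k} (a : Vec ℤ (2 + k)) w g → AllNonZero a → linform a w ≡ 1ℤ → ∀ ε → 0ℚ ℚ.< ε →
              totalShift a w * ↧ₙ ε * n ^ k < solutionCount n a →
              ratio (liftedMonoCount n a g) (solutionCount n a) ℚ.≤ ratio (modMonoCount a g) (modSolutionCount a) ℚ.+ ε
  density-≤ n {k} a w g a≢0 aw≡1 ε 0<ε shift<Tn =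
    ratio-≤-+ Mn Tn Mg Tm ε 0<ε (≤-trans (s≤s z≤n) shift<Tn) (1≤modSolutionCount a) (begin
      Tm * Mn * q                     ≤⟨ *-monoˡ-≤ q (monoCount-≤ n a w g a≢0 aw≡1) ⟩
      (Mg * Tn + C * n ^ k) * q       ≡⟨ *-distribʳ-+ q (Mg * Tn) (C * n ^ k) ⟩
      Mg * Tn * q + C * n ^ k * q     ≡⟨ cong (Mg * Tn * q +_) (reorder C (n ^ k) q) ⟩
      Mg * Tn * q + C * q * n ^ k     ≤⟨ +-monoʳ-≤ (Mg * Tn * q) (≤-trans (<⇒≤ shift<Tn)
                                                                          (m≤m*n Tn Tm {{>-nonZero (1≤modSolutionCount a)}})) ⟩
      Mg * Tn * q + Tn * Tm           ∎)
    where
    open ≤-Reasoning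
    q  = ↧ₙ ε
    C  = totalShift a w
    Tm = modSolutionCount a
    Tn = solutionCount n a
    Mg = modMonoCount a g
    Mn = liftedMonoCount n a g
    reorder : ∀ C p q → C * p * q ≡ C * q * p
    reorder = solve-∀

  density-eventually-≤ : ∀ {k} (a : Vec ℤ (2 + k)) w g → AllNonZero a → 1 ≤ posWeight a → 1 ≤ negWeight a →
                         linform a w ≡ 1ℤ → ∀ ε → 0ℚ ℚ.< ε → ∃ λ N₀ → ∀ n → N₀ ≤ n →
                         ratio (liftedMonoCount n a g) (solutionCount n a) ℚ.≤ ratio (modMonoCount a g) (modSolutionCount a) ℚ.+ ε
  density-eventually-≤ {k} a w g a≢0 1≤P 1≤Q aw≡1 ε 0<ε =
    N₀ , λ n N₀≤n → density-≤ n a w g a≢0 aw≡1 ε 0<ε (shift<count n N₀≤n)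
    where
    C : ℕ
    C = totalShift a w * ↧ₙ ε
    dominated : ∃ λ N₀ → ∀ n → N₀ ≤ n → C * n ^ k < cubeSum n (2 + k) (𝟙 ∘ isSolution a)
    dominated = solutionCount-dominates a a≢0 1≤P 1≤Q C
    N₀ : ℕ
    N₀ = proj₁ dominated
    shift<count : ∀ n → N₀ ≤ n → C * n ^ k < solutionCount n a
    shift<count n N₀≤n = subst (C * n ^ k <_) (cubeSum-solutions n a) (proj₂ dominated n N₀≤n)

open LinearForm using (bézoutᵛ; 1≤posWeight; 1≤negWeight)
open Colouring using (μmin-attained; μmin-≤; μmin-≤1)
open import Data.Integer using (ℤ; 0ℤ; 1ℤ)
open import Data.Rational using (ℚ; 0ℚ; 1ℚ; _+_)
open import Data.Nat using (zero; suc; _≤_)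
open import Data.Sum using (inj₁; inj₂)
open import Data.Empty using (⊥-elim)
import Data.Integer.Properties as ℤ
import Data.Rational.Properties as ℚ

lemma2p2 : (k : ℕ) (a : Vec ℤ k)
    → (∀ i → lookup a i ≢ 0ℤ)
    → gcdV a ≡ 1ℤ
    → (∃ λ i → 0ℤ Data.Integer.< lookup a i) × (∃ λ j → lookup a j Data.Integer.< 0ℤ)
    → (m : ℕ) → .{{_ : NonZero m}}
    → ∀ (ε : ℚ) → 0ℚ Data.Rational.< ε
    → ∃ λ N → ∀ n → N ≤ n → μ[n] a n Data.Rational.≤ μℤ a m + ε
lemma2p2 zero          a         _   _     ((() , _) , _) m ε _
lemma2p2 (suc zero)    (a₀ ∷ []) _   _     ((Fin.zero , 0<a₀) , (Fin.zero , a₀<0)) m ε _ = ⊥-elim (ℤ.<-asym 0<a₀ a₀<0)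
lemma2p2 (suc (suc k)) a         a≢0 gcd≡1 ((i , 0<aᵢ) , (j , aⱼ<0)) m ε 0<ε with μmin-attained m (solMod a m)
... | inj₁ μℤ≡1 = 0 , λ n _ → begin
  μ[n] a n      ≤⟨ μmin-≤1 n (solInt a n) ⟩
  1ℚ            ≡⟨ ℚ.+-identityʳ 1ℚ ⟨
  1ℚ + 0ℚ       ≤⟨ ℚ.+-monoʳ-≤ 1ℚ (ℚ.<⇒≤ 0<ε) ⟩
  1ℚ + ε        ≡⟨ cong (_+ ε) μℤ≡1 ⟨
  μℤ a m + ε    ∎
  where open ℚ.≤-Reasoning
... | inj₂ (g , μℤ≡μg) = N₀ , λ n N₀≤n → begin
  μ[n] a n                                           ≤⟨ μmin-≤ n (solInt a n) (liftColouring g) ⟩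
  μf n (solInt a n) (liftColouring g)                ≡⟨ μf-lifted n a g ⟩
  ratio (liftedMonoCount n a g) (solutionCount n a)  ≤⟨ proj₂ eventually n N₀≤n ⟩
  ratio (modMonoCount a g) (modSolutionCount a) + ε  ≡⟨ cong (_+ ε) (trans μℤ≡μg (μf-residues a g)) ⟨
  μℤ a m + ε                                         ∎
  where
  open ℚ.≤-Reasoning
  open Density m
  open ResidueClasses m using (modSolutionCount; modMonoCount; solutionCount; liftedMonoCount)
  w : Vec ℤ (suc (suc k))
  w = proj₁ (bézoutᵛ a)
  eventually : ∃ λ N₀ → ∀ n → N₀ ≤ n →
               ratio (liftedMonoCount n a g) (solutionCount n a) Data.Rational.≤ ratio (modMonoCount a g) (modSolutionCount a) + ε
  eventually = density-eventually-≤ a w g a≢0 (1≤posWeight a i 0<aᵢ) (1≤negWeight a j aⱼ<0)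
                                    (trans (proj₂ (bézoutᵛ a)) gcd≡1) ε 0<ε
  N₀ : ℕ
  N₀ = proj₁ eventually
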